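{- Let $T$ be a finite tree, $v \in V(T)$, and let $\ell$ be an integer with $\ell \geqslant 0$ and $\ell \geqslant t_v + 1$. Let $T(v, \ell)$ be the tree obtained from $T$ by identifying $v$ with an end vertex of an extra (disjoint) $\ell$-path. Then $T \cong \mathbb{L}_\ell(T(v,\ell)) = \mathbb{P}_\ell(T(v,\ell))$.
   Context: All graphs are undirected and loopless. For a finite tree $T$ and a vertex $v$ of degree $d$ in $T$, the integer $t_v$ is defined as follows: if $d \geqslant 2$, then $t_v := \operatorname{diam}(T)$; if $d \leqslant 1$ and $T$ is a path, then $t_v := -1$; otherwise $d = 1$, and taking a path $[v, \ldots, e, u]$ of minimum length from $v$ to a vertex $u$ with $\deg_T(u) \geqslant 3$ (with last edge $e$), $t_v := \operatorname{diam}(T_e^u)$, where $T_e^u$ is the component of $T - e$ containing $u$. An $\ell$-link of a graph is a walk of length $\ell$ in which consecutive edges are different (identified with its reverse); an $\ell$-path is an $\ell$-link without repeated vertices. The $\ell$-link graph $\mathbb{L}_\ell(G)$ has as vertices the $\ell$-links of $G$, and for every $(\ell+1)$-link $[v_0, e_1, \ldots, e_{\ell+1}, v_{\ell+1}]$ of $G$ one edge joining $[v_0, e_1, \ldots, e_\ell, v_\ell]$ and $[v_1, \ldots, e_{\ell+1}, v_{\ell+1}]$. The $\ell$-path graph $\mathbb{P}_\ell(G)$ is the simple graph whose vertices are the $\ell$-paths of $G$, two being adjacent if the union of the two paths forms a path or a cycle of length $\ell+1$ in $G$. -}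

module Defs where

open import Data.Nat using (ℕ; zero; suc; _+_; _≤_)
open import Data.Integer as ℤ using (ℤ; +_; -[1+_])
open import Data.Fin using (Fin; toℕ; splitAt)
open import Data.Vec using (Vec; []; _∷_; lookup; reverse; init; tail; head; last; _++_)
open import Data.Product using (Σ; ∃; _×_; _,_)
open import Data.Sum using (_⊎_; inj₁; inj₂)
open import Data.Unit using (⊤)
open import Data.Empty using (⊥)
open import Relation.Nullary using (¬_)
open import Relation.Binary.PropositionalEquality using (_≡_; _≢_)
open import Function.Bundles using (_⇔_)

-- A graph on the vertex set Fin n, given by its adjacency relation.
-- (Finite simple graphs; edges are determined by their end vertices.)
Graph : ℕ → Set₁
Graph n = Fin n → Fin n → Set

module _ {n : ℕ} (E : Graph n) where

  IsWalk : ∀ {m} → Vec (Fin n) m → Set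
  IsWalk (x ∷ y ∷ r) = E x y × IsWalk (y ∷ r)
  IsWalk _ = ⊤

  -- consecutive edges are different: in a simple graph the edges
  -- {x,y} and {y,z} coincide iff x ≡ z
  NoBacktrack : ∀ {m} → Vec (Fin n) m → Set
  NoBacktrack (x ∷ y ∷ z ∷ r) = x ≢ z × NoBacktrack (y ∷ z ∷ r)
  NoBacktrack _ = ⊤

  Distinct : ∀ {m} → Vec (Fin n) m → Set
  Distinct {m} xs = ∀ (i j : Fin m) → lookup xs i ≡ lookup xs j → i ≡ j

  -- an ℓ-link is given by its vertex sequence of length ℓ+1
  IsLink : ∀ {m} → Vec (Fin n) m → Set
  IsLink xs = IsWalk xs × NoBacktrack xs

  IsPathV : ∀ {m} → Vec (Fin n) m → Set
  IsPathV xs = IsLink xs × Distinct xs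

  -- a cycle of length k+1 ≥ 3 traversed as a closed walk v0 … v(k+1) = v0
  IsCycleV : ∀ {k} → Vec (Fin n) (suc (suc k)) → Set
  IsCycleV {k} xs = IsWalk xs × head xs ≡ last xs × 2 ≤ k × Distinct (init xs)

  WalkOfLen : Fin n → Fin n → ℕ → Set
  WalkOfLen x y d = Σ (Vec (Fin n) (suc d)) λ xs → IsWalk xs × head xs ≡ x × last xs ≡ y

  Connected : Set
  Connected = ∀ x y → ∃ λ d → WalkOfLen x y d

  IsDist : Fin n → Fin n → ℕ → Set
  IsDist x y d = WalkOfLen x y d × (∀ d' → WalkOfLen x y d' → d ≤ d')

  -- diameter of the subgraph induced on the vertices satisfying P
  -- (used for whole graphs and for connected components, which are
  --  closed under walks, so distances in them are the ambient ones)
  IsDiamOn : (Fin n → Set) → ℕ → Set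
  IsDiamOn P D =
    (∃ λ x → ∃ λ y → P x × P y × IsDist x y D) ×
    (∀ x y d → P x → P y → IsDist x y d → d ≤ D)

  IsDiam : ℕ → Set
  IsDiam = IsDiamOn (λ _ → ⊤)

  DegAtLeast2 : Fin n → Set
  DegAtLeast2 v = ∃ λ a → ∃ λ b → E v a × E v b × a ≢ b

  DegAtLeast3 : Fin n → Set
  DegAtLeast3 v = ∃ λ a → ∃ λ b → ∃ λ c →
    E v a × E v b × E v c × a ≢ b × a ≢ c × b ≢ c

  IsTree : Set
  IsTree =
    (∀ x y → E x y → E y x) ×
    (∀ x → ¬ E x x) ×
    Connected ×
    (∀ k (xs : Vec (Fin n) (suc (suc (suc k)))) → IsPathV xs → ¬ E (last xs) (head xs))

  IsPathGraph : Set
  IsPathGraph = ∃ λ k → Σ (Vec (Fin n) (suc k)) λ xs →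
    Distinct xs × (∀ x → ∃ λ i → lookup xs i ≡ x) ×
    (∀ x y → E x y ⇔ Consec xs x y)
    where
    Consec : ∀ {m} → Vec (Fin n) m → Fin n → Fin n → Set
    Consec (a ∷ b ∷ r) x y = ((x ≡ a × y ≡ b) ⊎ (x ≡ b × y ≡ a)) ⊎ Consec (b ∷ r) x y
    Consec _ _ _ = ⊥

DeleteEdge : ∀ {n} → Graph n → Fin n → Fin n → Graph n
DeleteEdge E w u a b = E a b × ¬ ((a ≡ w × b ≡ u) ⊎ (a ≡ u × b ≡ w))

data IsTV {n : ℕ} (E : Graph n) (v : Fin n) : ℤ → Set where
  deg≥2 : ∀ D → DegAtLeast2 E v → IsDiam E D → IsTV E v (+ D)
  path  : ¬ DegAtLeast2 E v → IsPathGraph E → IsTV E v -[1+ 0 ]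
  leaf  : ∀ {k} (ys : Vec (Fin n) k) (u : Fin n) D →
          ¬ DegAtLeast2 E v → ¬ IsPathGraph E →
          IsPathV E ((v ∷ ys) ++ (u ∷ [])) → DegAtLeast3 E u →
          (∀ {m} (zs : Vec (Fin n) m) (u' : Fin n) → IsPathV E ((v ∷ zs) ++ (u' ∷ [])) →
             DegAtLeast3 E u' → k ≤ m) →
          -- D = diam of the component of T − e containing u, e = {w,u}
          IsDiamOn (DeleteEdge E (last (v ∷ ys)) u)
                   (λ x → ∃ λ d → WalkOfLen (DeleteEdge E (last (v ∷ ys)) u) u x d) D →
          IsTV E v (+ D)

-- T(v,ℓ): identify v with an end vertex of an extra ℓ-path.
-- Vertices Fin (n + ℓ): the first n are those of T, the new vertices
-- n, n+1, …, n+ℓ-1 form the path v — n — n+1 — … — n+ℓ-1.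

Attach : ∀ {n} → Graph n → Fin n → (ℓ : ℕ) → Graph (n + ℓ)
Attach {n} E v ℓ i j = go (splitAt n i) (splitAt n j)
  where
  go : Fin n ⊎ Fin ℓ → Fin n ⊎ Fin ℓ → Set
  go (inj₁ a) (inj₁ b) = E a b
  go (inj₁ a) (inj₂ k) = a ≡ v × toℕ k ≡ 0
  go (inj₂ k) (inj₁ a) = a ≡ v × toℕ k ≡ 0
  go (inj₂ k) (inj₂ m) = suc (toℕ k) ≡ toℕ m ⊎ suc (toℕ m) ≡ toℕ k

-- ℓ-link graph and ℓ-path graph.  An ℓ-link is given by a vertex sequence
-- Vec (Fin N) (suc ℓ); links are identified with their reverses.

_≈L_ : ∀ {A : Set} {m} → Vec A m → Vec A m → Set
xs ≈L ys = xs ≡ ys ⊎ xs ≡ reverse ys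

Joins : ∀ {A : Set} {ℓ} → Vec A (suc (suc ℓ)) → Vec A (suc ℓ) → Vec A (suc ℓ) → Set
Joins R P Q = (init R ≈L P × tail R ≈L Q) ⊎ (init R ≈L Q × tail R ≈L P)

module _ {N : ℕ} (G : Graph N) (ℓ : ℕ) where

  -- adjacency in the ℓ-path graph ℙ_ℓ(G): the union of P and Q is a path or a
  -- cycle of length ℓ+1
  PAdj : Vec (Fin N) (suc ℓ) → Vec (Fin N) (suc ℓ) → Set
  PAdj P Q = Σ (Vec (Fin N) (suc (suc ℓ))) λ R →
    (IsPathV G R ⊎ IsCycleV G R) × Joins R P Q

  -- 𝕃_ℓ(G) = ℙ_ℓ(G): the ℓ-links are exactly the ℓ-paths, and between two
  -- ℓ-links there is no edge of 𝕃_ℓ(G) (edges = (ℓ+1)-links up to reversal)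
  -- unless they are adjacent in ℙ_ℓ(G), in which case there is exactly one.
  LinkGraph≡PathGraph : Set
  LinkGraph≡PathGraph =
    (∀ (P : Vec (Fin N) (suc ℓ)) → IsLink G P → IsPathV G P) ×
    (∀ P Q → IsPathV G P → IsPathV G Q →
       (∀ R → IsLink G R → Joins R P Q → PAdj P Q) ×
       (PAdj P Q →
          (Σ (Vec (Fin N) (suc (suc ℓ))) λ R → IsLink G R × Joins R P Q) ×
          (∀ R R' → IsLink G R → IsLink G R' → Joins R P Q → Joins R' P Q → R ≈L R')))

-- T ≅ ℙ_ℓ(G): a bijection between V(T) and the ℓ-paths of G up to reversal
-- preserving and reflecting adjacency
Iso-PathGraph : ∀ {n N} → Graph n → Graph N → ℕ → Set
Iso-PathGraph {n} {N} E G ℓ =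
  Σ (Fin n → Vec (Fin N) (suc ℓ)) λ f →
    (∀ x → IsPathV G (f x)) ×
    (∀ x y → f x ≈L f y → x ≡ y) ×
    (∀ P → IsPathV G P → ∃ λ x → f x ≈L P) ×
    (∀ x y → E x y ⇔ PAdj G ℓ (f x) (f y))

module Submission where

-- Root the tree T at v and write depth x for the distance from v to x and
-- parent x for the neighbour of x on the path to v.  In G = T(v,ℓ) every
-- vertex gets a height: ℓ + depth x for old vertices, and the new path
-- v — n — n+1 — … — n+ℓ-1 descends from height ℓ-1 to 0.  Every edge of G joins
-- a vertex to its unique parent (the neighbour one level lower), so an
-- ℓ-link of G either climbs monotonically ("up"/"down" chains, which are paths),
-- or has a valley: it goes up to a vertex a and back down along two different
-- children of a.  Such a valley of length L ≥ ℓ lies inside T and yields two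
-- vertices x, y at distance ≥ L (a potential-function argument); this
-- contradicts t_v < ℓ, since if deg v ≥ 2 the diameter of T is at least L,
-- and if v is a leaf, x and y lie in the component of T − e containing the
-- degree-≥3 vertex u closest to v.  Hence every ℓ- or (ℓ+1)-link of G is an
-- up- or down-chain, and x ↦ (the up-chain of length ℓ from x) is the required
-- isomorphism T ≅ ℙ_ℓ(G) = 𝕃_ℓ(G).

open import Defs

module Development where
  open import Data.Nat using (ℕ; zero; suc; pred; _+_; _≤_; _<_; z≤n; s≤s; _∸_; _≤?_; _<?_; ≢-nonZero)
  import Data.Integer as ℤ
  import Data.Nat as ℕ
  open import Data.Nat.Properties hiding (_≟_)
  open import Data.Nat.Tactic.RingSolver using (solve-∀)
  open import Data.Fin using (Fin; zero; suc; toℕ; _≟_; _↑ˡ_; _↑ʳ_; splitAt; join; fromℕ<)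
  open import Data.Fin.Properties
    using (any?; splitAt-↑ˡ; splitAt-↑ʳ; join-splitAt; toℕ-injective; toℕ<n; toℕ-fromℕ<; ↑ˡ-injective)
  open import Data.Vec using (Vec; []; _∷_; lookup; reverse; init; tail; head; last; _++_; _∷ʳ_; initLast)
  open import Data.Vec.Properties
    using (reverse-∷; last-reverse; init-reverse; reverse-involutive; reverse-reverse)
  open import Data.Product using (Σ; ∃; _×_; _,_; proj₁; proj₂)
  open import Data.Sum using (_⊎_; inj₁; inj₂; [_,_]′)
  open import Data.Unit using (⊤; tt)
  open import Data.Empty using (⊥; ⊥-elim)
  open import Relation.Nullary using (¬_; Dec; yes; no)
  open import Relation.Nullary.Decidable using (_⊎-dec_; _×-dec_; ¬?; map′)
  open import Relation.Binary.PropositionalEquality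
  open import Function.Bundles using (Equivalence; _⇔_; mk⇔)

  ∸-suc′ : ∀ {l m} → suc m ≤ l → l ∸ m ≡ suc (l ∸ suc m)
  ∸-suc′ (s≤s le) = +-∸-assoc 1 le

  module _ {A : Set} where

    -- Defs.Distinct without its (unused) graph parameter
    Dist : ∀ {m} → Vec A m → Set
    Dist {m} xs = ∀ (i j : Fin m) → lookup xs i ≡ lookup xs j → i ≡ j

    dist-tail : ∀ {m} {x : A} {xs : Vec A m} → Dist (x ∷ xs) → Dist xs
    dist-tail d i j eq = suc-inj (d (suc i) (suc j) eq)
      where
      suc-inj : ∀ {m} {i j : Fin m} → _≡_ {A = Fin (suc m)} (suc i) (suc j) → i ≡ j
      suc-inj refl = refl

    dist-head : ∀ {m} {x : A} {xs : Vec A m} → Dist (x ∷ xs) → ∀ j → lookup xs j ≢ x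
    dist-head d j eq with d zero (suc j) (sym eq)
    ... | ()

    dist-cons : ∀ {m} {x : A} {xs : Vec A m} → (∀ j → lookup xs j ≢ x) → Dist xs → Dist (x ∷ xs)
    dist-cons nx d zero zero eq = refl
    dist-cons nx d zero (suc j) eq = ⊥-elim (nx j (sym eq))
    dist-cons nx d (suc i) zero eq = ⊥-elim (nx i eq)
    dist-cons nx d (suc i) (suc j) eq = cong suc (d i j eq)

    last-++ : ∀ {m} (x : A) (xs : Vec A m) (u : A) → last ((x ∷ xs) ++ (u ∷ [])) ≡ u
    last-++ x [] u = refl
    last-++ x (y ∷ xs) u = last-++ y xs u

    penult : ∀ {m} → Vec A (suc (suc m)) → A
    penult (a ∷ b ∷ []) = a
    penult (a ∷ b ∷ c ∷ r) = penult (b ∷ c ∷ r)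

    penult-mem : ∀ {m} (ys : Vec A (suc (suc (suc m)))) → ∃ λ j → lookup ys (suc j) ≡ penult ys
    penult-mem (a ∷ b ∷ c ∷ []) = zero , refl
    penult-mem (a ∷ b ∷ c ∷ d ∷ r) with penult-mem (b ∷ c ∷ d ∷ r)
    ... | j , eq = suc j , eq

    head-lookup : ∀ {m} (xs : Vec A (suc m)) → lookup xs zero ≡ head xs
    head-lookup (x ∷ r) = refl

    head-init : ∀ {m} (xs : Vec A (suc (suc m))) → head (init xs) ≡ head xs
    head-init (x ∷ y ∷ r) = refl

    ≈sym : ∀ {m} {xs ys : Vec A m} → xs ≈L ys → ys ≈L xs
    ≈sym (inj₁ eq) = inj₁ (sym eq)
    ≈sym (inj₂ eq) = inj₂ (sym (reverse-reverse (sym eq)))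

    ≈revl : ∀ {m} {xs ys : Vec A m} → xs ≈L ys → reverse xs ≈L ys
    ≈revl (inj₁ eq) = inj₂ (cong reverse eq)
    ≈revl {ys = ys} (inj₂ eq) = inj₁ (trans (cong reverse eq) (reverse-involutive ys))

    ≈revl⁻ : ∀ {m} {xs ys : Vec A m} → reverse xs ≈L ys → xs ≈L ys
    ≈revl⁻ {xs = xs} h = subst (_≈L _) (reverse-involutive xs) (≈revl h)

    ≈trans : ∀ {m} {xs ys zs : Vec A m} → xs ≈L ys → ys ≈L zs → xs ≈L zs
    ≈trans (inj₁ refl) h = h
    ≈trans (inj₂ refl) h = ≈revl h

    tail-reverse : ∀ {m} (xs : Vec A (suc m)) → tail (reverse xs) ≡ reverse (init xs)
    tail-reverse xs = sym (reverse-reverse (sym (trans (cong init (sym (reverse-involutive xs)))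
                                                      (init-reverse (reverse xs)))))

    joins-resp : ∀ {ℓ} {R : Vec A (suc (suc ℓ))} {P Q P' Q'} →
                 Joins R P Q → P ≈L P' → Q ≈L Q' → Joins R P' Q'
    joins-resp (inj₁ (a , b)) p q = inj₁ (≈trans a p , ≈trans b q)
    joins-resp (inj₂ (a , b)) p q = inj₂ (≈trans a q , ≈trans b p)

    init-reverse-≈ : ∀ {ℓ} (R : Vec A (suc (suc ℓ))) {P} → tail R ≈L P → init (reverse R) ≈L P
    init-reverse-≈ R h = subst (_≈L _) (sym (init-reverse R)) (≈revl h)

    tail-reverse-≈ : ∀ {ℓ} (R : Vec A (suc (suc ℓ))) {P} → init R ≈L P → tail (reverse R) ≈L P
    tail-reverse-≈ R h = subst (_≈L _) (sym (tail-reverse R)) (≈revl h)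

    joins-reverse : ∀ {ℓ} {R : Vec A (suc (suc ℓ))} {P Q} → Joins R P Q → Joins (reverse R) P Q
    joins-reverse {R = R} (inj₁ (a , b)) = inj₂ (init-reverse-≈ R b , tail-reverse-≈ R a)
    joins-reverse {R = R} (inj₂ (a , b)) = inj₁ (init-reverse-≈ R b , tail-reverse-≈ R a)

  module Walks {n : ℕ} (E : Graph n) where

    data Walk : Fin n → Fin n → ℕ → Set where
      nil  : ∀ {x} → Walk x x 0
      cons : ∀ {x y z d} → E x y → Walk y z d → Walk x z (suc d)

    _∈W_ : ∀ {x y d} → Fin n → Walk x y d → Set
    a ∈W (nil {x}) = a ≡ x
    a ∈W (cons {x} e w) = a ≡ x ⊎ a ∈W w

    _∈W?_ : ∀ {x y d} (a : Fin n) (w : Walk x y d) → Dec (a ∈W w)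
    a ∈W? (nil {x}) = a ≟ x
    a ∈W? (cons {x} e w) = (a ≟ x) ⊎-dec (a ∈W? w)

    IsPath : ∀ {x y d} → Walk x y d → Set
    IsPath nil = ⊤
    IsPath (cons {x} e w) = ¬ (x ∈W w) × IsPath w

    _⊆W_ : ∀ {x y d x' y' d'} → Walk x y d → Walk x' y' d' → Set
    w ⊆W w' = ∀ z → z ∈W w → z ∈W w'

    last-mem : ∀ {x y d} (w : Walk x y d) → y ∈W w
    last-mem nil = refl
    last-mem (cons e w) = inj₂ (last-mem w)

    vertices : ∀ {x y d} → Walk x y d → Vec (Fin n) (suc d)
    vertices (nil {x}) = x ∷ []
    vertices (cons {x} e w) = x ∷ vertices w

    head-vertices : ∀ {x y d} (w : Walk x y d) → head (vertices w) ≡ x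
    head-vertices nil = refl
    head-vertices (cons e w) = refl

    last-vertices : ∀ {x y d} (w : Walk x y d) → last (vertices w) ≡ y
    last-vertices nil = refl
    last-vertices (cons e nil) = refl
    last-vertices (cons e (cons e' w)) = last-vertices (cons e' w)

    walk-vertices : ∀ {x y d} (w : Walk x y d) → IsWalk E (vertices w)
    walk-vertices nil = tt
    walk-vertices (cons e nil) = e , tt
    walk-vertices (cons e (cons e' w)) = e , walk-vertices (cons e' w)

    lookup-mem : ∀ {x y d} (w : Walk x y d) (i : Fin (suc d)) → lookup (vertices w) i ∈W w
    lookup-mem nil zero = refl
    lookup-mem (cons e w) zero = inj₁ refl
    lookup-mem (cons e w) (suc i) = inj₂ (lookup-mem w i)

    dist-vertices : ∀ {x y d} (w : Walk x y d) → IsPath w → Dist (vertices w)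
    dist-vertices nil _ zero zero _ = refl
    dist-vertices (cons e w) (nx , p) =
      dist-cons (λ j eq → nx (subst (_∈W w) eq (lookup-mem w j))) (dist-vertices w p)

    distinct-noBacktrack : ∀ {m} (xs : Vec (Fin n) m) → Dist xs → NoBacktrack E xs
    distinct-noBacktrack [] d = tt
    distinct-noBacktrack (x ∷ []) d = tt
    distinct-noBacktrack (x ∷ y ∷ []) d = tt
    distinct-noBacktrack (x ∷ y ∷ z ∷ r) d =
      (λ eq → 0≢2 (d zero (suc (suc zero)) eq)) , distinct-noBacktrack (y ∷ z ∷ r) (dist-tail d)
      where
      0≢2 : ∀ {m} → _≡_ {A = Fin (suc (suc (suc m)))} zero (suc (suc zero)) → ⊥
      0≢2 ()

    distinct-path : ∀ {m} (xs : Vec (Fin n) m) → IsWalk E xs → Dist xs → IsPathV E xs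
    distinct-path xs iw d = (iw , distinct-noBacktrack xs d) , d

    path-vertices : ∀ {x y d} (w : Walk x y d) → IsPath w → IsPathV E (vertices w)
    path-vertices w p = distinct-path (vertices w) (walk-vertices w) (dist-vertices w p)

    fromVec : ∀ {d} (xs : Vec (Fin n) (suc d)) → IsWalk E xs → Walk (head xs) (last xs) d
    fromVec (x ∷ []) _ = nil
    fromVec (x ∷ y ∷ r) (e , iw) = cons e (fromVec (y ∷ r) iw)

    fromWalkOfLen : ∀ {x y d} → WalkOfLen E x y d → Walk x y d
    fromWalkOfLen (xs , iw , refl , refl) = fromVec xs iw

    toWalkOfLen : ∀ {x y d} → Walk x y d → WalkOfLen E x y d
    toWalkOfLen w = vertices w , walk-vertices w , head-vertices w , last-vertices w

    fromVec-mem : ∀ {d} (xs : Vec (Fin n) (suc d)) (iw : IsWalk E xs) a → a ∈W fromVec xs iw → ∃ λ i → lookup xs i ≡ a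
    fromVec-mem (x ∷ []) _ a refl = zero , refl
    fromVec-mem (x ∷ y ∷ r) (e , iw) a (inj₁ refl) = zero , refl
    fromVec-mem (x ∷ y ∷ r) (e , iw) a (inj₂ m) = let i , eq = fromVec-mem (y ∷ r) iw a m in suc i , eq

    fromVec-path : ∀ {d} (xs : Vec (Fin n) (suc d)) (iw : IsWalk E xs) → Dist xs → IsPath (fromVec xs iw)
    fromVec-path (x ∷ []) _ _ = tt
    fromVec-path (x ∷ y ∷ r) (e , iw) d =
      (λ m → let i , eq = fromVec-mem (y ∷ r) iw x m in dist-head d i eq) , fromVec-path (y ∷ r) iw (dist-tail d)

    _++W_ : ∀ {x y z d d'} → Walk x y d → Walk y z d' → Walk x z (d + d')
    nil ++W q = q
    cons e p ++W q = cons e (p ++W q)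

    mem-++ : ∀ {x y z d d'} (p : Walk x y d) (q : Walk y z d') a → a ∈W (p ++W q) → a ∈W p ⊎ a ∈W q
    mem-++ nil q a m = inj₂ m
    mem-++ (cons e p) q a (inj₁ eq) = inj₁ (inj₁ eq)
    mem-++ (cons e p) q a (inj₂ m) = [ (λ m' → inj₁ (inj₂ m')) , inj₂ ]′ (mem-++ p q a m)

    snoc : ∀ {x y z d} → Walk x y d → E y z → Walk x z (suc d)
    snoc nil e = cons e nil
    snoc (cons e' w) e = cons e' (snoc w e)

    mem-snoc : ∀ {x y z d} (w : Walk x y d) (e : E y z) a → a ∈W snoc w e → a ∈W w ⊎ a ≡ z
    mem-snoc nil e a (inj₁ eq) = inj₁ eq
    mem-snoc nil e a (inj₂ eq) = inj₂ eq
    mem-snoc (cons e' w) e a (inj₁ eq) = inj₁ (inj₁ eq)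
    mem-snoc (cons e' w) e a (inj₂ m) = [ (λ m' → inj₁ (inj₂ m')) , inj₂ ]′ (mem-snoc w e a m)

    snoc-path : ∀ {x y z d} (w : Walk x y d) (e : E y z) → IsPath w → ¬ (z ∈W w) → IsPath (snoc w e)
    snoc-path nil e _ nz = (λ eq → nz (sym eq)) , tt
    snoc-path (cons {x} e' w) e (nx , p) nz =
      (λ m → [ nx , (λ eq → nz (inj₁ (sym eq))) ]′ (mem-snoc w e x m)) ,
      snoc-path w e p (λ m → nz (inj₂ m))

    -- the vertex before the last one (the start, for a trivial walk)
    penultimate : ∀ {x y d} → Walk x y d → Fin n
    penultimate (nil {x}) = x
    penultimate (cons {x} e nil) = x
    penultimate (cons e (cons e' w)) = penultimate (cons e' w)

    penultimate-snoc : ∀ {x y z d} (w : Walk x y d) (e : E y z) → penultimate (snoc w e) ≡ y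
    penultimate-snoc nil e = refl
    penultimate-snoc (cons e' nil) e = refl
    penultimate-snoc (cons e' (cons e'' w)) e = penultimate-snoc (cons e'' w) e

    unsnoc : ∀ {x y d} (w : Walk x y (suc d)) →
      Σ (Walk x (penultimate w) d) λ w' → E (penultimate w) y × (IsPath w → IsPath w') × w' ⊆W w
    unsnoc (cons e nil) = nil , e , (λ _ → tt) , λ z m → inj₁ m
    unsnoc (cons {x} e (cons e' w)) with unsnoc (cons e' w)
    ... | w' , e'' , f , sub = cons e w' , e'' , (λ { (nx , p) → (λ m → nx (sub x m)) , f p }) ,
          λ { z (inj₁ eq) → inj₁ eq ; z (inj₂ m) → inj₂ (sub z m) }

    split : ∀ {x y d a} (w : Walk x y d) → a ∈W w →
      Σ ℕ λ d1 → Σ ℕ λ d2 → Σ (Walk x a d1) λ p → Σ (Walk a y d2) λ q →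
        (d1 + d2 ≡ d) × (IsPath w → IsPath p × IsPath q) × p ⊆W w × q ⊆W w
    split nil refl = 0 , 0 , nil , nil , refl , (λ _ → tt , tt) , (λ z m → m) , (λ z m → m)
    split {d = suc d} (cons e w) (inj₁ refl) =
      0 , suc d , nil , cons e w , refl , (λ ip → tt , ip) , (λ z m → inj₁ m) , (λ z m → m)
    split (cons {x} e w) (inj₂ m) with split w m
    ... | d1 , d2 , p , q , eq , f , subp , subq =
      suc d1 , d2 , cons e p , q , cong suc eq ,
      (λ { (nx , ip) → ((λ mm → nx (subp x mm)) , proj₁ (f ip)) , proj₂ (f ip) }) ,
      (λ { z (inj₁ e') → inj₁ e' ; z (inj₂ mm) → inj₂ (subp z mm) }) ,
      (λ z mm → inj₂ (subq z mm))

    -- every walk contains a path with the same ends (cut out the loops)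
    shortcut : ∀ {x y d} (w : Walk x y d) → Σ ℕ λ d' → Σ (Walk x y d') λ p → IsPath p × p ⊆W w
    shortcut nil = 0 , nil , tt , λ z m → m
    shortcut (cons {x} e w) with shortcut w
    ... | d' , p , ip , sub with x ∈W? p
    ...   | no nx = suc d' , cons e p , (nx , ip) , λ { z (inj₁ eq) → inj₁ eq ; z (inj₂ m) → inj₂ (sub z m) }
    ...   | yes m with split p m
    ...     | _ , d2 , _ , suf , _ , f , _ , subq = d2 , suf , proj₂ (f ip) , λ z mm → inj₂ (sub z (subq z mm))

    -- a cycle, traversed as a closed walk, is a link: it does not backtrack
    -- at its closing vertex, because the vertex before it differs from the first
    cycle-link : ∀ {k} (R : Vec (Fin n) (suc (suc k))) → IsCycleV E R → IsLink E R
    cycle-link {suc (suc k)} R (iw , closed , s≤s (s≤s z≤n) , di) = iw ,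
      subst (NoBacktrack E) (sym (proj₂ (proj₂ (initLast R))))
        (noBacktrack-snoc (init R) (last R) (distinct-noBacktrack (init R) di) penult≢last)
      where
      noBacktrack-snoc : ∀ {m} (ys : Vec (Fin n) (suc (suc m))) z → NoBacktrack E ys → penult ys ≢ z →
                         NoBacktrack E (ys ∷ʳ z)
      noBacktrack-snoc (a ∷ b ∷ []) z _ pn = pn , tt
      noBacktrack-snoc (a ∷ b ∷ c ∷ r) z (a≢c , nb) pn = a≢c , noBacktrack-snoc (b ∷ c ∷ r) z nb pn
      penult≢last : penult (init R) ≢ last R
      penult≢last eq with penult-mem (init R)
      ... | j , e with di zero (suc j) (trans (head-lookup (init R)) (trans (head-init R) (trans closed (sym (trans e eq)))))
      ...   | ()

    module Reverse (symE : ∀ {x y} → E x y → E y x) where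
      rev : ∀ {x y d} → Walk x y d → Walk y x d
      rev nil = nil
      rev (cons e w) = snoc (rev w) (symE e)

      mem-rev : ∀ {x y d} (w : Walk x y d) → rev w ⊆W w
      mem-rev nil z m = m
      mem-rev (cons e w) z m = [ (λ m' → inj₂ (mem-rev w z m')) , inj₁ ]′ (mem-snoc (rev w) (symE e) z m)

  module RootedTree {n : ℕ} (T : Graph n) (tree : IsTree T) (v : Fin n) where
    open Walks T

    symT : ∀ {x y} → T x y → T y x
    symT = proj₁ tree _ _

    irreflT : ∀ x → ¬ T x x
    irreflT = proj₁ (proj₂ tree)

    connected : Connected T
    connected = proj₁ (proj₂ (proj₂ tree))

    acyclic : ∀ k (xs : Vec (Fin n) (suc (suc (suc k)))) → IsPathV T xs → ¬ T (last xs) (head xs)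
    acyclic = proj₂ (proj₂ (proj₂ tree))

    open Reverse symT

    no-cycle : ∀ {a b k} (p : Walk a b (suc (suc k))) → IsPath p → ¬ T b a
    no-cycle {k = k} p ip e =
      acyclic k (vertices p) (path-vertices p ip) (subst₂ T (sym (last-vertices p)) (sym (head-vertices p)) e)

    paths-unique : ∀ {a b d d'} (p : Walk a b d) (q : Walk a b d') → IsPath p → IsPath q →
                   d ≡ d' × penultimate p ≡ penultimate q
    paths-unique nil nil _ _ = refl , refl
    paths-unique nil (cons e q) _ (nq , _) = ⊥-elim (nq (last-mem q))
    paths-unique (cons e p) nil (np , _) _ = ⊥-elim (np (last-mem p))
    paths-unique {b = b} (cons {a} {p1} e1 p') (cons {.a} {q1} e2 q') (np , ip) (nq , iq) with p1 ≟ q1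
    ... | yes refl = let d≡ , pen≡ = paths-unique p' q' ip iq in cong suc d≡ , same-penultimate p' q' d≡ pen≡
      where
      same-penultimate : ∀ {d d'} (p' : Walk p1 b d) (q' : Walk p1 b d') → d ≡ d' →
        penultimate p' ≡ penultimate q' → penultimate (cons e1 p') ≡ penultimate (cons e2 q')
      same-penultimate nil nil _ _ = refl
      same-penultimate (cons _ _) (cons _ _) _ eq = eq
    ... | no p1≢q1 with shortcut (p' ++W rev q')
    ...   | _ , r , ir , sub = ⊥-elim (closes-cycle r ir (λ m → a∉ (sub a m)))
      where
      -- p1 … q1 avoiding a, together with the edges a p1 and a q1, would be a cycle
      a∉ : ¬ (a ∈W (p' ++W rev q'))
      a∉ m = [ np , (λ m2 → nq (mem-rev q' a m2)) ]′ (mem-++ p' (rev q') a m)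
      closes-cycle : ∀ {dr} (r : Walk p1 q1 dr) → IsPath r → ¬ (a ∈W r) → ⊥
      closes-cycle nil _ _ = p1≢q1 refl
      closes-cycle (cons e r') ir na = no-cycle (cons e1 (cons e r')) (na , ir) (symT e2)

    rootPath′ : ∀ x → Σ ℕ λ d → Σ (Walk v x d) IsPath
    rootPath′ x with shortcut (fromWalkOfLen (proj₂ (connected v x)))
    ... | d' , p , ip , _ = d' , p , ip

    depth : Fin n → ℕ
    depth x = proj₁ (rootPath′ x)

    rootPath : ∀ x → Walk v x (depth x)
    rootPath x = proj₁ (proj₂ (rootPath′ x))

    rootPath-path : ∀ x → IsPath (rootPath x)
    rootPath-path x = proj₂ (proj₂ (rootPath′ x))

    parent : Fin n → Fin n
    parent x = penultimate (rootPath x)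

    by-rootPath : ∀ {x d} (q : Walk v x d) → IsPath q → depth x ≡ d × parent x ≡ penultimate q
    by-rootPath q ip = paths-unique (rootPath _) q (rootPath-path _) ip

    depth-root : depth v ≡ 0
    depth-root = proj₁ (by-rootPath nil tt)

    depth0⇒root : ∀ x → depth x ≡ 0 → x ≡ v
    depth0⇒root x eq = trivial (rootPath x) eq
      where
      trivial : ∀ {d} (w : Walk v x d) → d ≡ 0 → x ≡ v
      trivial nil _ = refl
      trivial (cons _ _) ()

    parent-edge : ∀ x → depth x ≢ 0 → T x (parent x) × depth x ≡ suc (depth (parent x))
    parent-edge x nz = last-edge (rootPath x) (rootPath-path x) nz
      where
      last-edge : ∀ {d} (w : Walk v x d) → IsPath w → d ≢ 0 → T x (penultimate w) × d ≡ suc (depth (penultimate w))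
      last-edge {zero} w _ nz = ⊥-elim (nz refl)
      last-edge {suc d} w ip nz with unsnoc w
      ... | w' , e , f , _ = symT e , cong suc (sym (proj₁ (by-rootPath w' (f ip))))

    edge-depth : ∀ {x y} → T x y → depth x ≡ suc (depth y) ⊎ depth y ≡ suc (depth x)
    edge-depth {x} {y} e with y ∈W? rootPath x
    ... | no y∉ = inj₂ (proj₁ (by-rootPath (snoc (rootPath x) e) (snoc-path (rootPath x) e (rootPath-path x) y∉)))
    ... | yes m with split (rootPath x) m
    ...   | d1 , d2 , pre , suf , eq , f , _ , _ = y-before-x suf (proj₂ (f (rootPath-path x))) eq
      where
      -- y lies on the path v … x, so it must be the vertex just before x
      y-before-x : ∀ {d2} (suf : Walk y x d2) → IsPath suf → d1 + d2 ≡ depth x →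
                   depth x ≡ suc (depth y) ⊎ depth y ≡ suc (depth x)
      y-before-x nil _ _ = ⊥-elim (irreflT x e)
      y-before-x (cons e' nil) _ eq' = inj₁ (begin
        depth x  ≡⟨ sym eq' ⟩
        d1 + 1   ≡⟨ +-comm d1 1 ⟩
        suc d1   ≡⟨ cong suc (sym (proj₁ (by-rootPath pre (proj₁ (f (rootPath-path x)))))) ⟩
        suc (depth y) ∎)
        where open ≡-Reasoning
      y-before-x (cons e' (cons e'' w)) ip _ = ⊥-elim (no-cycle (cons e' (cons e'' w)) ip e)

    path-through : ∀ {x y} → T x y → depth x ≡ suc (depth y) →
                   Σ (Walk v x (suc (depth y))) λ w → IsPath w × penultimate w ≡ y
    path-through {x} {y} e eq with x ∈W? rootPath y
    ... | no x∉ = snoc (rootPath y) (symT e) , snoc-path (rootPath y) (symT e) (rootPath-path y) x∉ ,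
                  penultimate-snoc (rootPath y) (symT e)
    ... | yes m with split (rootPath y) m
    ...   | d1 , d2 , pre , _ , eq2 , f , _ , _ = ⊥-elim (<-irrefl refl (begin-strict
      depth y          <⟨ n<1+n (depth y) ⟩
      suc (depth y)    ≡⟨ sym eq ⟩
      depth x          ≡⟨ proj₁ (by-rootPath pre (proj₁ (f (rootPath-path y)))) ⟩
      d1               ≤⟨ m≤m+n d1 d2 ⟩
      d1 + d2          ≡⟨ eq2 ⟩
      depth y          ∎))
      where open ≤-Reasoning

    lower-unique : ∀ {x y y'} → T x y → T x y' → depth x ≡ suc (depth y) → depth x ≡ suc (depth y') → y ≡ y'
    lower-unique e e' eq eq' with path-through e eq | path-through e' eq'
    ... | w , ip , pw | w' , ip' , pw' = trans (sym pw) (trans (proj₂ (paths-unique w w' ip ip')) pw')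

    -- adjacency in a tree is decidable: x y adjacent iff one is the other's parent
    decT : ∀ x y → Dec (T x y)
    decT x y = map′ from to ((¬? (depth x ℕ.≟ 0) ×-dec (parent x ≟ y)) ⊎-dec (¬? (depth y ℕ.≟ 0) ×-dec (parent y ≟ x)))
      where
      IsParentOf : Fin n → Fin n → Set
      IsParentOf x y = depth x ≢ 0 × parent x ≡ y
      from : IsParentOf x y ⊎ IsParentOf y x → T x y
      from (inj₁ (nz , refl)) = proj₁ (parent-edge x nz)
      from (inj₂ (nz , refl)) = symT (proj₁ (parent-edge y nz))
      lower : ∀ {x y} → T x y → depth x ≡ suc (depth y) → IsParentOf x y
      lower {x} e eq = let nz = λ z → 0≢1+n (trans (sym z) eq) in
        nz , lower-unique (proj₁ (parent-edge x nz)) e (proj₂ (parent-edge x nz)) eq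
      to : T x y → IsParentOf x y ⊎ IsParentOf y x
      to e = [ (λ eq → inj₁ (lower e eq)) , (λ eq → inj₂ (lower (symT e) eq)) ]′ (edge-depth e)

  -- Rooted trees and
  -- T(v,ℓ) are instances.

  module RootedGraph {N : ℕ} (E : Graph N) (h : Fin N → ℕ) (par : Fin N → Fin N)
    (symE : ∀ {x y} → E x y → E y x)
    (edge-height : ∀ {x y} → E x y → h x ≡ suc (h y) ⊎ h y ≡ suc (h x))
    (lower-unique : ∀ {x y y'} → E x y → E x y' → h x ≡ suc (h y) → h x ≡ suc (h y') → y ≡ y')
    (par-edge : ∀ x → h x ≢ 0 → E x (par x) × h x ≡ suc (h (par x))) where

    open Walks E

    -- Parent x y : y is the parent of x
    Parent : Fin N → Fin N → Set
    Parent x y = E x y × h x ≡ suc (h y)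

    parent-unique : ∀ {x y y'} → Parent x y → Parent x y' → y ≡ y'
    parent-unique p p' = lower-unique (proj₁ p) (proj₁ p') (proj₂ p) (proj₂ p')

    par-parent : ∀ x → h x ≢ 0 → Parent x (par x)
    par-parent = par-edge

    parent≡par : ∀ {x y} → Parent x y → y ≡ par x
    parent≡par {x} p = parent-unique p (par-parent x λ z → 0≢1+n (trans (sym z) (proj₂ p)))

    parent-asym : ∀ {a b} → Parent a b → Parent b a → ⊥
    parent-asym {a} {b} (_ , e1) (_ , e2) = <-irrefl refl (begin-strict
      h a  <⟨ n<1+n (h a) ⟩  suc (h a)  <⟨ s≤s (≤-reflexive (sym e2)) ⟩  suc (h b)  ≡⟨ sym e1 ⟩  h a  ∎)
      where open ≤-Reasoning

    edge-parent : ∀ {x y} → E x y → Parent x y ⊎ Parent y x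
    edge-parent e = [ (λ eq → inj₁ (e , eq)) , (λ eq → inj₂ (symE e , eq)) ]′ (edge-height e)

    data Ascent : Fin N → Fin N → ℕ → Set where
      here : ∀ {x} → Ascent x x 0
      step : ∀ {x y z k} → Parent x y → Ascent y z k → Ascent x z (suc k)

    ascent-height : ∀ {x c k} → Ascent x c k → h x ≡ k + h c
    ascent-height here = refl
    ascent-height (step p u) = trans (proj₂ p) (cong suc (ascent-height u))

    ascent-unique : ∀ {x c c' k} → Ascent x c k → Ascent x c' k → c ≡ c'
    ascent-unique here here = refl
    ascent-unique (step p u) (step p' u') with parent-unique p p'
    ... | refl = ascent-unique u u'

    ascent-trans : ∀ {x y z i j} → Ascent x y i → Ascent y z j → Ascent x z (i + j)
    ascent-trans here u = u
    ascent-trans (step p u) u' = step p (ascent-trans u u')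

    ancestor : ℕ → Fin N → Fin N
    ancestor zero z = z
    ancestor (suc k) z = ancestor k (par z)

    ancestor-suc : ∀ k z → ancestor (suc k) z ≡ par (ancestor k z)
    ancestor-suc zero z = refl
    ancestor-suc (suc k) z = ancestor-suc k (par z)

    ancestor-ascent : ∀ k z → k ≤ h z → Ascent z (ancestor k z) k
    ancestor-ascent zero z _ = here
    ancestor-ascent (suc k) z le =
      let p = par-parent z (λ z0 → 0≢1+n (sym (n≤0⇒n≡0 (subst (suc k ≤_) z0 le)))) in
      step p (ancestor-ascent k (par z) (≤-pred (subst (suc k ≤_) (proj₂ p) le)))

    ascent-ancestor : ∀ {z c k} → Ascent z c k → ancestor k z ≡ c
    ascent-ancestor here = refl
    ascent-ancestor (step p u) with parent≡par p
    ... | refl = ascent-ancestor u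

    ancestor-height : ∀ k z → k ≤ h z → h (ancestor k z) ≡ h z ∸ k
    ancestor-height k z le = sym (trans (cong (_∸ k) (ascent-height (ancestor-ascent k z le))) (m+n∸m≡n k _))

    ancestor-parent : ∀ k z → suc k ≤ h z → Parent (ancestor k z) (ancestor (suc k) z)
    ancestor-parent k z le = subst (Parent (ancestor k z)) (sym (ancestor-suc k z))
      (par-parent (ancestor k z) λ z0 → 0≢1+n (sym (trans (sym (∸-suc′ le)) (trans (sym (ancestor-height k z (<⇒≤ le))) z0))))

    Below : Fin N → Fin N → Set
    Below c z = Σ ℕ (Ascent z c)

    below? : ∀ c z → Dec (Below c z)
    below? c z with h c ≤? h z
    ... | no nle = no λ { (k , u) → nle (subst (h c ≤_) (sym (ascent-height u)) (m≤n+m (h c) k)) }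
    ... | yes le with ancestor (h z ∸ h c) z ≟ c
    ...   | yes eq = yes (h z ∸ h c , subst (λ c' → Ascent z c' (h z ∸ h c)) eq
                                              (ancestor-ascent (h z ∸ h c) z (m∸n≤m (h z) (h c))))
    ...   | no ne = no λ { (k , u) → ne (trans (cong (λ k' → ancestor k' z) (sym (steps u))) (ascent-ancestor u)) }
      where
      steps : ∀ {k} → Ascent z c k → k ≡ h z ∸ h c
      steps {k} u = trans (sym (m+n∸n≡m k (h c))) (cong (_∸ h c) (sym (ascent-height u)))

    Up : ∀ {L} → Vec (Fin N) (suc L) → Set
    Up (x ∷ []) = ⊤
    Up (x ∷ y ∷ r) = Parent x y × Up (y ∷ r)

    Down : ∀ {L} → Vec (Fin N) (suc L) → Set
    Down (x ∷ []) = ⊤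
    Down (x ∷ y ∷ r) = Parent y x × Down (y ∷ r)

    chain : Fin N → (L : ℕ) → Vec (Fin N) (suc L)
    chain x zero = x ∷ []
    chain x (suc L) = x ∷ chain (par x) L

    head-chain : ∀ x L → head (chain x L) ≡ x
    head-chain x zero = refl
    head-chain x (suc L) = refl

    init-chain : ∀ z L → init (chain z (suc L)) ≡ chain z L
    init-chain z zero = refl
    init-chain z (suc L) = cong (z ∷_) (init-chain (par z) L)

    up-cons : ∀ {L} x (xs : Vec (Fin N) (suc L)) → Parent x (head xs) → Up xs → Up (x ∷ xs)
    up-cons x (y ∷ r) p u = p , u

    chain-up : ∀ x L → L ≤ h x → Up (chain x L)
    chain-up x zero _ = tt
    chain-up x (suc L) le =
      up-cons x (chain (par x) L) (subst (Parent x) (sym (head-chain (par x) L)) p)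
              (chain-up (par x) L (≤-pred (subst (suc L ≤_) (proj₂ p) le)))
      where
      p : Parent x (par x)
      p = par-parent x (λ z → 0≢1+n (sym (n≤0⇒n≡0 (subst (suc L ≤_) z le))))

    up-chain : ∀ {L} (xs : Vec (Fin N) (suc L)) → Up xs → xs ≡ chain (head xs) L
    up-chain (x ∷ []) _ = refl
    up-chain (x ∷ y ∷ r) (p , u) with parent≡par p
    ... | refl = cong (x ∷_) (up-chain (y ∷ r) u)

    up-height : ∀ {L} (xs : Vec (Fin N) (suc L)) → Up xs → L ≤ h (head xs)
    up-height (x ∷ []) _ = z≤n
    up-height (x ∷ y ∷ r) (p , u) = subst (suc _ ≤_) (sym (proj₂ p)) (s≤s (up-height (y ∷ r) u))

    up-lower : ∀ {L} (x : Fin N) (xs : Vec (Fin N) (suc L)) → Up (x ∷ xs) → ∀ j → h (lookup xs j) < h x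
    up-lower x (y ∷ r) (p , u) zero = ≤-reflexive (sym (proj₂ p))
    up-lower x (y ∷ z ∷ r) (p , u) (suc j) = <-trans (up-lower y (z ∷ r) u j) (≤-reflexive (sym (proj₂ p)))

    down-higher : ∀ {L} (x : Fin N) (xs : Vec (Fin N) (suc L)) → Down (x ∷ xs) → ∀ j → h x < h (lookup xs j)
    down-higher x (y ∷ r) (p , u) zero = ≤-reflexive (sym (proj₂ p))
    down-higher x (y ∷ z ∷ r) (p , u) (suc j) = <-trans (≤-reflexive (sym (proj₂ p))) (down-higher y (z ∷ r) u j)

    up-path : ∀ {L} (xs : Vec (Fin N) (suc L)) → Up xs → IsPathV E xs
    up-path xs u = distinct-path xs (walk xs u) (distinct xs u)
      where
      walk : ∀ {L} (xs : Vec (Fin N) (suc L)) → Up xs → IsWalk E xs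
      walk (x ∷ []) _ = tt
      walk (x ∷ y ∷ r) (p , u) = proj₁ p , walk (y ∷ r) u
      distinct : ∀ {L} (xs : Vec (Fin N) (suc L)) → Up xs → Dist xs
      distinct (x ∷ []) _ zero zero _ = refl
      distinct (x ∷ y ∷ r) (p , u) =
        dist-cons (λ j eq → <-irrefl (cong h eq) (up-lower x (y ∷ r) (p , u) j)) (distinct (y ∷ r) u)

    down-path : ∀ {L} (xs : Vec (Fin N) (suc L)) → Down xs → IsPathV E xs
    down-path xs d = distinct-path xs (walk xs d) (distinct xs d)
      where
      walk : ∀ {L} (xs : Vec (Fin N) (suc L)) → Down xs → IsWalk E xs
      walk (x ∷ []) _ = tt
      walk (x ∷ y ∷ r) (p , d) = symE (proj₁ p) , walk (y ∷ r) d
      distinct : ∀ {L} (xs : Vec (Fin N) (suc L)) → Down xs → Dist xs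
      distinct (x ∷ []) _ zero zero _ = refl
      distinct (x ∷ y ∷ r) (p , d) =
        dist-cons (λ j eq → <-irrefl (cong h (sym eq)) (down-higher x (y ∷ r) (p , d) j)) (distinct (y ∷ r) d)

    up-snoc : ∀ {L} (zs : Vec (Fin N) (suc L)) a → Up zs → Parent (last zs) a → Up (zs ∷ʳ a)
    up-snoc (z ∷ []) a _ p = p , tt
    up-snoc (z ∷ z' ∷ r) a (p' , u) p = p' , up-snoc (z' ∷ r) a u p

    down-snoc : ∀ {L} (zs : Vec (Fin N) (suc L)) a → Down zs → Parent a (last zs) → Down (zs ∷ʳ a)
    down-snoc (z ∷ []) a _ p = p , tt
    down-snoc (z ∷ z' ∷ r) a (p' , u) p = p' , down-snoc (z' ∷ r) a u p

    down-reverse : ∀ {L} (xs : Vec (Fin N) (suc L)) → Down xs → Up (reverse xs)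
    down-reverse (x ∷ []) _ = tt
    down-reverse (x ∷ y ∷ r) (p , d) = subst Up (sym (reverse-∷ x (y ∷ r)))
      (up-snoc (reverse (y ∷ r)) x (down-reverse (y ∷ r) d) (subst (λ z → Parent z x) (sym (last-reverse (y ∷ r))) p))

    up-reverse : ∀ {L} (xs : Vec (Fin N) (suc L)) → Up xs → Down (reverse xs)
    up-reverse (x ∷ []) _ = tt
    up-reverse (x ∷ y ∷ r) (p , d) = subst Down (sym (reverse-∷ x (y ∷ r)))
      (down-snoc (reverse (y ∷ r)) x (up-reverse (y ∷ r) d) (subst (λ z → Parent x z) (sym (last-reverse (y ∷ r))) p))

    up-not-down : ∀ {L} (xs : Vec (Fin N) (suc (suc L))) → Up xs → Down xs → ⊥
    up-not-down (x ∷ y ∷ r) (p , _) (q , _) = parent-asym p q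

    down-ascent : ∀ {L} (xs : Vec (Fin N) (suc L)) → Down xs → Ascent (last xs) (head xs) L
    down-ascent (x ∷ []) _ = here
    down-ascent (x ∷ y ∷ r) (p , d) =
      subst (Ascent (last (y ∷ r)) x) (+-comm _ 1) (ascent-trans (down-ascent (y ∷ r) d) (step p here))

    strictAncestors : Fin N → (k : ℕ) → Vec (Fin N) k
    strictAncestors z zero = []
    strictAncestors z (suc k) = ancestor (suc k) z ∷ strictAncestors z k

    ancestors-down : ∀ z k → suc k ≤ h z → Down ((ancestor (suc k) z ∷ strictAncestors z k) ++ (z ∷ []))
    ancestors-down z zero le = ancestor-parent 0 z le , tt
    ancestors-down z (suc k) le = ancestor-parent (suc k) z le , ancestors-down z k (<⇒≤ le)

    last-strictAncestors : ∀ z y k → last (y ∷ strictAncestors z (suc k)) ≡ par z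
    last-strictAncestors z y zero = refl
    last-strictAncestors z y (suc k) = last-strictAncestors z (ancestor (suc (suc k)) z) k

    record ForkFrom (x : Fin N) (L : ℕ) : Set where
      constructor fork
      field
        apex b1 b2 y : Fin N
        i j : ℕ
        b1-child : Parent b1 apex
        b2-child : Parent b2 apex
        b1≢b2 : b1 ≢ b2
        x-below : Ascent x b1 i
        y-below : Ascent y b2 j
        size : L ≡ suc i + suc j

    Fork : ℕ → Set
    Fork L = Σ (Fin N) λ x → ForkFrom x L

    FirstUp : ∀ {L} → Vec (Fin N) (suc L) → Set
    FirstUp (x ∷ []) = ⊥
    FirstUp (x ∷ y ∷ r) = Parent x y

    Valley : ∀ {L} → Vec (Fin N) (suc L) → Set
    Valley {L} xs = FirstUp xs × ForkFrom (head xs) L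

    noBacktrack-tail : ∀ {L} {x} (xs : Vec (Fin N) (suc L)) → NoBacktrack E (x ∷ xs) → NoBacktrack E xs
    noBacktrack-tail (y ∷ []) _ = tt
    noBacktrack-tail (y ∷ z ∷ r) (_ , nb) = nb

    -- every link is an up-chain, a down-chain, or a valley: a link cannot turn
    -- up after going down, since that would return to the same parent
    classify : ∀ {L} (xs : Vec (Fin N) (suc L)) → IsLink E xs → Up xs ⊎ Down xs ⊎ Valley xs
    classify (x ∷ []) _ = inj₁ tt
    classify (x ∷ y ∷ r) ((e , iw) , nb) with classify (y ∷ r) (iw , noBacktrack-tail (y ∷ r) nb) | edge-parent e
    ... | inj₁ up | inj₁ px = inj₁ (px , up)
    ... | inj₂ (inj₁ dn) | inj₁ px = turn r nb dn
      where
      turn : ∀ {L} (r : Vec (Fin N) L) → NoBacktrack E (x ∷ y ∷ r) → Down (y ∷ r) →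
             Up (x ∷ y ∷ r) ⊎ Down (x ∷ y ∷ r) ⊎ Valley (x ∷ y ∷ r)
      turn [] _ _ = inj₁ (px , tt)
      turn (z ∷ r') (x≢z , _) (pz , dn') =
        inj₂ (inj₂ (px , fork y x z (last (z ∷ r')) 0 _ px pz x≢z here (down-ascent (z ∷ r') dn') refl))
    ... | inj₂ (inj₂ (_ , fork a b1 b2 yb i j p1 p2 ne u1 u2 eqL)) | inj₁ px =
      inj₂ (inj₂ (px , fork a b1 b2 yb (suc i) j p1 p2 ne (step px u1) u2 (cong suc eqL)))
    ... | inj₂ (inj₁ dn) | inj₂ py = inj₂ (inj₁ (py , dn))
    ... | inj₁ up | inj₂ py = rise r nb up
      where
      rise : ∀ {L} (r : Vec (Fin N) L) → NoBacktrack E (x ∷ y ∷ r) → Up (y ∷ r) →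
             Up (x ∷ y ∷ r) ⊎ Down (x ∷ y ∷ r) ⊎ Valley (x ∷ y ∷ r)
      rise [] _ _ = inj₂ (inj₁ (py , tt))
      rise (z ∷ r') (x≢z , _) (pz , _) = ⊥-elim (x≢z (parent-unique py pz))
    ... | inj₂ (inj₂ (fu , _)) | inj₂ py = rise r nb fu
      where
      rise : ∀ {L} (r : Vec (Fin N) L) → NoBacktrack E (x ∷ y ∷ r) → FirstUp (y ∷ r) →
             Up (x ∷ y ∷ r) ⊎ Down (x ∷ y ∷ r) ⊎ Valley (x ∷ y ∷ r)
      rise [] _ ()
      rise (z ∷ r') (x≢z , _) pz = ⊥-elim (x≢z (parent-unique py pz))

    -- Proof by a potential
    -- Φ that changes by at most one along every edge: Φ z = h z + h y on the
    -- subtree below b1 and Φ z = h y + 2 h a ∸ h z elsewhere, so that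
    -- Φ x - Φ y = (h x - h a) + (h y - h a) = L.
    module ForkPotential {x L} (F : ForkFrom x L) where
      open ForkFrom F renaming (apex to a)

      A K : ℕ
      A = h y
      K = A + (h a + h a)

      potential : ∀ z → Dec (Below b1 z) → ℕ
      potential z (yes _) = h z + A
      potential z (no _) = K ∸ h z

      Φ : Fin N → ℕ
      Φ z = potential z (below? b1 z)

      leave : ∀ {p q} → Parent p q → Below b1 p → ¬ Below b1 q → p ≡ b1
      leave {p} pq (zero , here) nq = refl
      leave {p} pq (suc k , step pr u) nq with parent-unique pq pr
      ... | refl = ⊥-elim (nq (k , u))

      enter : ∀ {p q} → Parent p q → Below b1 q → Below b1 p
      enter pq (k , u) = suc k , step pq u

      y-outside : ¬ Below b1 y
      y-outside (k , u) with +-cancelʳ-≡ (h b1) k j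
        (trans (sym (ascent-height u)) (trans (ascent-height y-below) (cong (j +_) (trans (proj₂ b2-child) (sym (proj₂ b1-child))))))
      ... | refl = b1≢b2 (ascent-unique u y-below)

      ∸-step : ∀ m k → m ∸ k ≤ suc (m ∸ suc k)
      ∸-step zero zero = z≤n
      ∸-step zero (suc k) = z≤n
      ∸-step (suc m) zero = s≤s ≤-refl
      ∸-step (suc m) (suc k) = ∸-step m k

      -- at the edge b1 → a the two formulas agree up to one
      K∸a : K ∸ h a ≡ A + h a
      K∸a = trans (cong (_∸ h a) (sym (+-assoc A (h a) (h a)))) (m+n∸n≡m (A + h a) (h a))

      b1-value : h b1 + A ≡ suc (K ∸ h a)
      b1-value = trans (cong (_+ A) (proj₂ b1-child)) (cong suc (trans (+-comm (h a) A) (sym K∸a)))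

      Φ-edge : ∀ {p q} → E p q → Φ p ≤ suc (Φ q)
      Φ-edge {p} {q} e with edge-parent e | below? b1 p | below? b1 q
      ... | inj₁ pq | yes _  | yes _  = ≤-reflexive (cong (_+ A) (proj₂ pq))
      ... | inj₁ pq | yes sp | no nsq with leave pq sp nsq
      ...   | refl with parent-unique pq b1-child
      ...     | refl = ≤-reflexive b1-value
      Φ-edge e | inj₁ pq | no nsp | yes sq = ⊥-elim (nsp (enter pq sq))
      Φ-edge {p} {q} e | inj₁ pq | no _ | no _ =
        ≤-trans (≤-reflexive (cong (K ∸_) (proj₂ pq))) (≤-trans (∸-monoʳ-≤ K (n≤1+n (h q))) (n≤1+n _))
      Φ-edge {p} {q} e | inj₂ qp | yes _ | yes _ =
        ≤-trans (m≤n+m (h p + A) 2) (≤-reflexive (cong (λ w → suc (w + A)) (sym (proj₂ qp))))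
      Φ-edge e | inj₂ qp | yes sp | no nsq = ⊥-elim (nsq (enter qp sp))
      Φ-edge e | inj₂ qp | no nsp | yes sq with leave qp sq nsp
      ...   | refl with parent-unique qp b1-child
      ...     | refl = ≤-trans (≤-reflexive (K∸a)) (≤-trans (≤-reflexive (+-comm A (h a)))
                         (≤-trans (m≤n+m (h a + A) 2) (≤-reflexive (cong (λ w → suc (w + A)) (sym (proj₂ b1-child))))))
      Φ-edge {p} e | inj₂ qp | no _ | no _ =
        ≤-trans (∸-step K (h p)) (≤-reflexive (cong (λ w → suc (K ∸ w)) (sym (proj₂ qp))))

      Φ-walk : ∀ {p q d} → Walk p q d → Φ p ≤ Φ q + d
      Φ-walk {p} nil = ≤-reflexive (sym (+-identityʳ (Φ p)))
      Φ-walk {p} {q} {suc d} (cons e w) =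
        ≤-trans (Φ-edge e) (≤-trans (s≤s (Φ-walk w)) (≤-reflexive (sym (+-suc (Φ q) d))))

      Φ-x : Φ x ≡ h x + A
      Φ-x with below? b1 x
      ... | yes _ = refl
      ... | no nx = ⊥-elim (nx (i , x-below))

      Φ-y : Φ y ≡ h a + h a
      Φ-y with below? b1 y
      ... | yes sy = ⊥-elim (y-outside sy)
      ... | no _ = m+n∸m≡n A (h a + h a)

      heights : h x + A ≡ L + (h a + h a)
      heights = begin
        h x + h y                          ≡⟨ cong₂ _+_ (ascent-height x-below) (ascent-height y-below) ⟩
        (i + h b1) + (j + h b2)            ≡⟨ cong₂ (λ s t → (i + s) + (j + t)) (proj₂ b1-child) (proj₂ b2-child) ⟩
        (i + suc (h a)) + (j + suc (h a))  ≡⟨ rearrange i j (h a) ⟩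
        (suc i + suc j) + (h a + h a)      ≡⟨ cong (_+ (h a + h a)) (sym size) ⟩
        L + (h a + h a)                    ∎
        where
        open ≡-Reasoning
        rearrange : ∀ i j a → (i + suc a) + (j + suc a) ≡ (suc i + suc j) + (a + a)
        rearrange = solve-∀

      distance : ∀ {d} → Walk x y d → L ≤ d
      distance {d} w = +-cancelʳ-≤ (h a + h a) L d
        (subst₂ _≤_ (trans Φ-x heights) (trans (cong (_+ d) Φ-y) (+-comm (h a + h a) d)) (Φ-walk w))

    fork-distance : ∀ {x L} (F : ForkFrom x L) {d} → Walk x (ForkFrom.y F) d → L ≤ d
    fork-distance F = ForkPotential.distance F

  least : (P : ℕ → Set) → (∀ d → Dec (P d)) → ∀ d0 → P d0 → Σ ℕ λ d → P d × ∀ d' → P d' → d ≤ d'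
  least P P? d0 p0 = search 0 d0 (+-identityʳ d0) (λ d' ())
    where
    search : ∀ k fuel → fuel + k ≡ d0 → (∀ d' → d' < k → ¬ P d') → Σ ℕ λ d → P d × ∀ d' → P d' → d ≤ d'
    search k fuel eq below with P? k
    ... | yes pk = k , pk , λ d' pd' → ≮⇒≥ (λ lt → below d' lt pd')
    search k zero eq below | no npk = ⊥-elim (npk (subst P (sym eq) p0))
    search k (suc fuel) eq below | no npk = search (suc k) fuel (trans (+-suc fuel k) eq) below′
      where
      below′ : ∀ d' → d' < suc k → ¬ P d'
      below′ d' lt pd' = [ (λ lt' → below d' lt' pd') , (λ { refl → npk pd' }) ]′ (m≤n⇒m<n∨m≡n (≤-pred lt))

  argmax : ∀ {m} (f : Fin m → ℕ) → Fin m → Σ (Fin m) λ i → ∀ j → f j ≤ f i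
  argmax {suc zero} f _ = zero , λ { zero → ≤-refl }
  argmax {suc (suc m)} f _ with argmax (λ j → f (suc j)) zero
  ... | i , mx with f zero ≤? f (suc i)
  ...   | yes le = suc i , λ { zero → le ; (suc j) → mx j }
  ...   | no nle = zero , λ { zero → ≤-refl ; (suc j) → ≤-trans (mx j) (<⇒≤ (≰⇒> nle)) }

  module Distances {n : ℕ} (E : Graph n) (decE : ∀ x y → Dec (E x y)) where
    open Walks E

    walk? : ∀ x y d → Dec (Walk x y d)
    walk? x y zero with x ≟ y
    ... | yes refl = yes nil
    ... | no ne = no λ { nil → ne refl }
    walk? x y (suc d) with any? (λ z → decE x z ×-dec walk? z y d)
    ... | yes (z , e , w) = yes (cons e w)
    ... | no nz = no λ { (cons {y = z} e w) → nz (z , e , w) }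

    distance : ∀ x y {d0} → Walk x y d0 → Σ ℕ λ d → IsDist E x y d
    distance x y w with least (Walk x y) (walk? x y) _ w
    ... | d , wd , mn = d , toWalkOfLen wd , λ d' wl → mn d' (fromWalkOfLen wl)

    distance-unique : ∀ {x y d d'} → IsDist E x y d → IsDist E x y d' → d ≡ d'
    distance-unique (w , m) (w' , m') = ≤-antisym (m _ w') (m' _ w)

    module Diameter (P : Fin n → Set) (P? : ∀ x → Dec (P x))
                    (joined : ∀ x y → P x → P y → Σ ℕ (Walk x y)) (x0 : Fin n) (px0 : P x0) where
      -- the distance between members of P, and 0 otherwise
      dist : Fin n → Fin n → ℕ
      dist x y with P? x | P? y
      ... | yes px | yes py = proj₁ (distance x y (proj₂ (joined x y px py)))
      ... | _ | _ = 0

      dist-ok : ∀ x y → P x → P y → IsDist E x y (dist x y)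
      dist-ok x y px py with P? x | P? y
      ... | yes px' | yes py' = proj₂ (distance x y (proj₂ (joined x y px' py')))
      ... | no npx | _ = ⊥-elim (npx px)
      ... | yes _ | no npy = ⊥-elim (npy py)

      dist-outside : ∀ x y → ¬ (P x × P y) → dist x y ≡ 0
      dist-outside x y out with P? x | P? y
      ... | yes px | yes py = ⊥-elim (out (px , py))
      ... | yes _ | no _ = refl
      ... | no _ | yes _ = refl
      ... | no _ | no _ = refl

      farthest : Fin n → Fin n
      farthest x = proj₁ (argmax (dist x) x0)

      mx my : Fin n
      mx = proj₁ (argmax (λ x → dist x (farthest x)) x0)
      my = farthest mx

      D : ℕ
      D = dist mx my

      maximal : ∀ x y → dist x y ≤ D
      maximal x y = ≤-trans (proj₂ (argmax (dist x) x0) y) (proj₂ (argmax (λ x → dist x (farthest x)) x0) x)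

      diam : IsDiamOn E P D
      diam = attained , λ x y d px py isd → subst (_≤ D) (distance-unique (dist-ok x y px py) isd) (maximal x y)
        where
        attained : ∃ λ x → ∃ λ y → P x × P y × IsDist E x y D
        attained with P? mx ×-dec P? my
        ... | yes (pa , pb) = mx , my , pa , pb , dist-ok mx my pa pb
        ... | no npp = x0 , x0 , px0 , px0 ,
                       subst (IsDist E x0 x0) (sym (dist-outside mx my npp)) (toWalkOfLen nil , λ _ _ → z≤n)

  -- Path graphs have no vertex of degree 3.  IsPathGraph uses a relation
  -- "consecutive in the list" that is local to its definition, so we argue
  -- for any relation C with the same unfolding: in a list without repetitions
  -- every vertex is C-related to at most two vertices.

  module Consecutive {n : ℕ} (C : ∀ {k} → Vec (Fin n) (suc k) → Fin n → Fin n → Set)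
    (unfold : ∀ {k a b x y} {r : Vec (Fin n) k} →
              C (a ∷ b ∷ r) x y → ((x ≡ a × y ≡ b) ⊎ (x ≡ b × y ≡ a)) ⊎ C (b ∷ r) x y)
    (C-singleton : ∀ {a x y} → ¬ C (a ∷ []) x y) where

    C-member : ∀ {k} (xs : Vec (Fin n) (suc k)) {a b} → C xs a b → ∃ λ i → lookup xs i ≡ a
    C-member (p ∷ []) c = ⊥-elim (C-singleton c)
    C-member (p ∷ q ∷ r) c with unfold c
    ... | inj₁ (inj₁ (refl , _)) = zero , refl
    ... | inj₁ (inj₂ (refl , _)) = suc zero , refl
    ... | inj₂ c' = let i , eq = C-member (q ∷ r) c' in suc i , eq

    first-neighbour : ∀ {k} (p : Fin n) (ys : Vec (Fin n) k) → Dist (p ∷ ys) →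
                      ∃ λ c → ∀ b → C (p ∷ ys) p b → b ≡ c
    first-neighbour p [] d = p , λ b c → ⊥-elim (C-singleton c)
    first-neighbour p (q ∷ r) d = q , λ b c → only b (unfold c)
      where
      only : ∀ b → ((p ≡ p × b ≡ q) ⊎ (p ≡ q × b ≡ p)) ⊎ C (q ∷ r) p b → b ≡ q
      only b (inj₁ (inj₁ (_ , eq))) = eq
      only b (inj₁ (inj₂ (eq , _))) = ⊥-elim (dist-head d zero (sym eq))
      only b (inj₂ c) = let i , eq = C-member (q ∷ r) c in ⊥-elim (dist-head d i eq)

    two-neighbours : ∀ {k} (xs : Vec (Fin n) (suc k)) → Dist xs → ∀ a →
                     ∃ λ c1 → ∃ λ c2 → ∀ b → C xs a b → b ≡ c1 ⊎ b ≡ c2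
    two-neighbours (p ∷ []) d a = a , a , λ b c → ⊥-elim (C-singleton c)
    two-neighbours (p ∷ q ∷ r) d a with a ≟ p | a ≟ q
    ... | yes refl | _ = let c , only = first-neighbour p (q ∷ r) d in c , c , λ b cb → inj₁ (only b cb)
    ... | no a≢p | yes refl =
      let c , only = first-neighbour q r (dist-tail d) in
      p , c , λ b cb → [ [ (λ e → ⊥-elim (a≢p (proj₁ e))) , (λ e → inj₁ (proj₂ e)) ]′ , (λ c' → inj₂ (only b c')) ]′ (unfold cb)
    ... | no a≢p | no a≢q =
      let c1 , c2 , only = two-neighbours (q ∷ r) (dist-tail d) a in
      c1 , c2 , λ b cb → [ [ (λ e → ⊥-elim (a≢p (proj₁ e))) , (λ e → ⊥-elim (a≢q (proj₁ e))) ]′ , only b ]′ (unfold cb)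

  pigeonhole : ∀ {A : Set} {b1 b2 b3 c1 c2 : A} → b1 ≡ c1 ⊎ b1 ≡ c2 → b2 ≡ c1 ⊎ b2 ≡ c2 → b3 ≡ c1 ⊎ b3 ≡ c2 →
               b1 ≢ b2 → b1 ≢ b3 → b2 ≢ b3 → ⊥
  pigeonhole (inj₁ refl) (inj₁ refl) _ n12 _ _ = n12 refl
  pigeonhole (inj₂ refl) (inj₂ refl) _ n12 _ _ = n12 refl
  pigeonhole (inj₁ refl) (inj₂ refl) (inj₁ refl) _ n13 _ = n13 refl
  pigeonhole (inj₁ refl) (inj₂ refl) (inj₂ refl) _ _ n23 = n23 refl
  pigeonhole (inj₂ refl) (inj₁ refl) (inj₁ refl) _ _ n23 = n23 refl
  pigeonhole (inj₂ refl) (inj₁ refl) (inj₂ refl) _ n13 _ = n13 refl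

  PathGraphVia : ∀ {n} → Graph n → (∀ {k} → Vec (Fin n) (suc k) → Fin n → Fin n → Set) → Set
  PathGraphVia {n} E C = ∃ λ k → Σ (Vec (Fin n) (suc k)) λ xs →
    Distinct E xs × (∀ x → ∃ λ i → lookup xs i ≡ x) × (∀ x y → E x y ⇔ C xs x y)

  path-graph-via-degree : ∀ {n} {E : Graph n} {C : ∀ {k} → Vec (Fin n) (suc k) → Fin n → Fin n → Set} →
    (∀ {k a b x y} {r : Vec (Fin n) k} → C (a ∷ b ∷ r) x y → ((x ≡ a × y ≡ b) ⊎ (x ≡ b × y ≡ a)) ⊎ C (b ∷ r) x y) →
    (∀ {a x y} → ¬ C (a ∷ []) x y) →
    PathGraphVia E C → ∀ a → ¬ DegAtLeast3 E a
  path-graph-via-degree {E = E} {C = C} unfold C-singleton (k , xs , d , _ , iff) a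
                        (b1 , b2 , b3 , e1 , e2 , e3 , n12 , n13 , n23) =
    pigeonhole (only b1 (adj b1 e1)) (only b2 (adj b2 e2)) (only b3 (adj b3 e3)) n12 n13 n23
    where
    adj : ∀ b → E a b → C xs a b
    adj b = Equivalence.to (iff a b)
    only = proj₂ (proj₂ (Consecutive.two-neighbours C unfold C-singleton xs d a))

  path-graph-degree : ∀ {n} {E : Graph n} → IsPathGraph E → ∀ a → ¬ DegAtLeast3 E a
  path-graph-degree = path-graph-via-degree (λ c → c) (λ ())

  -- Old vertices a ↑ˡ ℓ have
  -- height ℓ + depth a; the new vertex n ↑ʳ k (at distance k+1 from v) has
  -- height ℓ ∸ (k+1).

  cast : ∀ {A B : Set} → A ≡ B → A → B
  cast = subst (λ X → X)

  m≢2+m : ∀ (m : ℕ) → m ≢ suc (suc m)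
  m≢2+m m eq = <-irrefl eq (≤-trans (n<1+n m) (n≤1+n (suc m)))

  module AttachedPath {n : ℕ} (T : Graph n) (tree : IsTree T) (v : Fin n) where
    open RootedTree T tree v

    data View (ℓ : ℕ) : Fin (n + ℓ) → Set where
      old : ∀ a → View ℓ (a ↑ˡ ℓ)
      new : ∀ k → View ℓ (n ↑ʳ k)

    view : ∀ ℓ i → View ℓ i
    view ℓ i = subst (View ℓ) (join-splitAt n ℓ i) (from-split (splitAt n i))
      where
      from-split : (s : Fin n ⊎ Fin ℓ) → View ℓ (join n ℓ s)
      from-split (inj₁ a) = old a
      from-split (inj₂ k) = new k

    module _ (ℓ : ℕ) where
      G : Graph (n + ℓ)
      G = Attach T v ℓ

      old-old : ∀ a b → G (a ↑ˡ ℓ) (b ↑ˡ ℓ) ≡ T a b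
      old-old a b rewrite splitAt-↑ˡ n a ℓ | splitAt-↑ˡ n b ℓ = refl
      old-new : ∀ a k → G (a ↑ˡ ℓ) (n ↑ʳ k) ≡ (a ≡ v × toℕ k ≡ 0)
      old-new a k rewrite splitAt-↑ˡ n a ℓ | splitAt-↑ʳ n ℓ k = refl
      new-old : ∀ k a → G (n ↑ʳ k) (a ↑ˡ ℓ) ≡ (a ≡ v × toℕ k ≡ 0)
      new-old k a rewrite splitAt-↑ˡ n a ℓ | splitAt-↑ʳ n ℓ k = refl
      new-new : ∀ k m → G (n ↑ʳ k) (n ↑ʳ m) ≡ (suc (toℕ k) ≡ toℕ m ⊎ suc (toℕ m) ≡ toℕ k)
      new-new k m rewrite splitAt-↑ʳ n ℓ k | splitAt-↑ʳ n ℓ m = refl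

      newHeight : Fin ℓ → ℕ
      newHeight k = ℓ ∸ suc (toℕ k)

      heightG : Fin (n + ℓ) → ℕ
      heightG i = [ (λ a → ℓ + depth a) , newHeight ]′ (splitAt n i)

      heightG-old : ∀ a → heightG (a ↑ˡ ℓ) ≡ ℓ + depth a
      heightG-old a rewrite splitAt-↑ˡ n a ℓ = refl
      heightG-new : ∀ k → heightG (n ↑ʳ k) ≡ newHeight k
      heightG-new k rewrite splitAt-↑ʳ n ℓ k = refl

    -- the first new vertex (and some vertex if there is none)
    first-new : ∀ ℓ → Fin (n + ℓ)
    first-new zero = v ↑ˡ 0
    first-new (suc l) = n ↑ʳ zero

    module _ (ℓ : ℕ) where
      parent-old : (a : Fin n) → Dec (a ≡ v) → Fin (n + ℓ)
      parent-old a (yes _) = first-new ℓ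
      parent-old a (no _) = parent a ↑ˡ ℓ

      parent-new : (k : Fin ℓ) → Dec (suc (toℕ k) < ℓ) → Fin (n + ℓ)
      parent-new k (yes lt) = n ↑ʳ fromℕ< lt
      parent-new k (no _) = n ↑ʳ k

      parG : Fin (n + ℓ) → Fin (n + ℓ)
      parG i = [ (λ a → parent-old a (a ≟ v)) , (λ k → parent-new k (suc (toℕ k) <? ℓ)) ]′ (splitAt n i)

      parG-old : ∀ a → parG (a ↑ˡ ℓ) ≡ parent-old a (a ≟ v)
      parG-old a rewrite splitAt-↑ˡ n a ℓ = refl
      parG-new : ∀ k → parG (n ↑ʳ k) ≡ parent-new k (suc (toℕ k) <? ℓ)
      parG-new k rewrite splitAt-↑ʳ n ℓ k = refl

    newHeight<ℓ : ∀ ℓ (k : Fin ℓ) → newHeight ℓ k < ℓ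
    newHeight<ℓ (suc l) k = s≤s (m∸n≤m l (toℕ k))

    new<old : ∀ ℓ k a → newHeight ℓ k < ℓ + depth a
    new<old ℓ k a = ≤-trans (newHeight<ℓ ℓ k) (m≤m+n ℓ (depth a))

    newHeight-step : ∀ ℓ (k m : Fin ℓ) → newHeight ℓ k ≡ suc (newHeight ℓ m) → toℕ m ≡ suc (toℕ k)
    newHeight-step ℓ k m eq = sym (∸-cancelˡ-≡ (toℕ<n k) (<⇒≤ (toℕ<n m)) (trans eq (sym (∸-suc′ (toℕ<n m)))))

    step-newHeight : ∀ ℓ (k m : Fin ℓ) → toℕ m ≡ suc (toℕ k) → newHeight ℓ k ≡ suc (newHeight ℓ m)
    step-newHeight ℓ k m eq = trans (cong (ℓ ∸_) (sym eq)) (∸-suc′ (toℕ<n m))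

    v-above-new : ∀ ℓ a (k : Fin ℓ) → a ≡ v → toℕ k ≡ 0 → ℓ + depth a ≡ suc (newHeight ℓ k)
    v-above-new ℓ a k refl eq = begin
      ℓ + depth v            ≡⟨ cong (ℓ +_) depth-root ⟩
      ℓ + 0                  ≡⟨ +-identityʳ ℓ ⟩
      ℓ                      ≡⟨ ∸-suc′ (subst (_< ℓ) eq (toℕ<n k)) ⟩
      suc (ℓ ∸ 1)            ≡⟨ cong (λ z → suc (ℓ ∸ suc z)) (sym eq) ⟩
      suc (newHeight ℓ k)    ∎
      where open ≡-Reasoning

    symG : ∀ ℓ {x y} → G ℓ x y → G ℓ y x
    symG ℓ {x} {y} e with view ℓ x | view ℓ y
    ... | old a | old b = cast (sym (old-old ℓ b a)) (symT (cast (old-old ℓ a b) e))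
    ... | old a | new k = cast (sym (new-old ℓ k a)) (cast (old-new ℓ a k) e)
    ... | new k | old a = cast (sym (old-new ℓ a k)) (cast (new-old ℓ k a) e)
    ... | new k | new m = cast (sym (new-new ℓ m k)) (swap (cast (new-new ℓ k m) e))
      where
      swap : ∀ {A B : Set} → A ⊎ B → B ⊎ A
      swap = [ inj₂ , inj₁ ]′

    edgeG : ∀ ℓ {x y} → G ℓ x y → heightG ℓ x ≡ suc (heightG ℓ y) ⊎ heightG ℓ y ≡ suc (heightG ℓ x)
    edgeG ℓ {x} {y} e with view ℓ x | view ℓ y
    ... | old a | old b rewrite heightG-old ℓ a | heightG-old ℓ b with edge-depth (cast (old-old ℓ a b) e)
    ...   | inj₁ eq = inj₁ (trans (cong (ℓ +_) eq) (+-suc ℓ (depth b)))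
    ...   | inj₂ eq = inj₂ (trans (cong (ℓ +_) eq) (+-suc ℓ (depth a)))
    edgeG ℓ e | old a | new k rewrite heightG-old ℓ a | heightG-new ℓ k with cast (old-new ℓ a k) e
    ...   | av , k0 = inj₁ (v-above-new ℓ a k av k0)
    edgeG ℓ e | new k | old a rewrite heightG-old ℓ a | heightG-new ℓ k with cast (new-old ℓ k a) e
    ...   | av , k0 = inj₂ (v-above-new ℓ a k av k0)
    edgeG ℓ e | new k | new m rewrite heightG-new ℓ k | heightG-new ℓ m with cast (new-new ℓ k m) e
    ...   | inj₁ eq = inj₁ (step-newHeight ℓ k m (sym eq))
    ...   | inj₂ eq = inj₂ (step-newHeight ℓ m k (sym eq))

    lowerG : ∀ ℓ {x y} → G ℓ x y → heightG ℓ x ≡ suc (heightG ℓ y) → y ≡ parG ℓ x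
    lowerG ℓ {x} {y} e eq with view ℓ x | view ℓ y
    ... | old a | old b rewrite heightG-old ℓ a | heightG-old ℓ b | parG-old ℓ a with a ≟ v
    ...   | yes refl = ⊥-elim (0≢1+n (trans (sym depth-root) (+-cancelˡ-≡ ℓ _ _ (trans eq (sym (+-suc ℓ (depth b)))))))
    ...   | no a≢v = let nz = λ z → a≢v (depth0⇒root a z) in
      cong (_↑ˡ ℓ) (lower-unique (cast (old-old ℓ a b) e) (proj₁ (parent-edge a nz))
                                 (+-cancelˡ-≡ ℓ _ _ (trans eq (sym (+-suc ℓ (depth b))))) (proj₂ (parent-edge a nz)))
    lowerG zero e eq | old a | new ()
    lowerG (suc l) e eq | old a | new k rewrite parG-old (suc l) a with cast (old-new (suc l) a k) e
    ...   | refl , k0 with v ≟ v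
    ...     | yes _ = cong (n ↑ʳ_) (toℕ-injective k0)
    ...     | no v≢v = ⊥-elim (v≢v refl)
    lowerG ℓ e eq | new k | old a rewrite heightG-old ℓ a | heightG-new ℓ k =
      ⊥-elim (<-asym (new<old ℓ k a) (subst (ℓ + depth a <_) (sym eq) (n<1+n _)))
    lowerG ℓ e eq | new k | new m rewrite heightG-new ℓ k | heightG-new ℓ m | parG-new ℓ k with cast (new-new ℓ k m) e
    ...   | inj₂ m<k = ⊥-elim (m≢2+m (toℕ m) (trans (newHeight-step ℓ k m eq) (cong suc (sym m<k))))
    ...   | inj₁ k<m with suc (toℕ k) <? ℓ
    ...     | yes lt = cong (n ↑ʳ_) (toℕ-injective (trans (sym k<m) (sym (toℕ-fromℕ< lt))))
    ...     | no nlt = ⊥-elim (nlt (subst (_< ℓ) (sym k<m) (toℕ<n m)))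

    parG-edge : ∀ ℓ x → heightG ℓ x ≢ 0 → G ℓ x (parG ℓ x) × heightG ℓ x ≡ suc (heightG ℓ (parG ℓ x))
    parG-edge ℓ x nz with view ℓ x
    ... | old a rewrite parG-old ℓ a | heightG-old ℓ a with a ≟ v
    ...   | no a≢v = let nzT = λ z → a≢v (depth0⇒root a z) in
            cast (sym (old-old ℓ a (parent a))) (proj₁ (parent-edge a nzT)) ,
            subst (λ w → ℓ + depth a ≡ suc w) (sym (heightG-old ℓ (parent a)))
                  (trans (cong (ℓ +_) (proj₂ (parent-edge a nzT))) (+-suc ℓ _))
    parG-edge zero x nz | old a | yes refl = ⊥-elim (nz depth-root)
    parG-edge (suc l) x nz | old a | yes refl =
      cast (sym (old-new (suc l) v zero)) (refl , refl) ,
      subst (λ w → suc l + depth v ≡ suc w) (sym (heightG-new (suc l) zero)) (v-above-new (suc l) v zero refl refl)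
    parG-edge ℓ x nz | new k rewrite parG-new ℓ k | heightG-new ℓ k with suc (toℕ k) <? ℓ
    ...   | yes lt = cast (sym (new-new ℓ k (fromℕ< lt))) (inj₁ (sym (toℕ-fromℕ< lt))) ,
            subst (λ w → newHeight ℓ k ≡ suc w) (sym (heightG-new ℓ (fromℕ< lt))) (step-newHeight ℓ k _ (toℕ-fromℕ< lt))
    ...   | no nlt = ⊥-elim (nz (m≤n⇒m∸n≡0 (≮⇒≥ nlt)))

    lower-uniqueG : ∀ ℓ {x y y'} → G ℓ x y → G ℓ x y' → heightG ℓ x ≡ suc (heightG ℓ y) →
                    heightG ℓ x ≡ suc (heightG ℓ y') → y ≡ y'
    lower-uniqueG ℓ e e' eq eq' = trans (lowerG ℓ e eq) (sym (lowerG ℓ e' eq'))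

  -- A valley in G can
  -- only turn at an old vertex (new vertices have at most one child), and
  -- everything above an old vertex is old, so a valley in G is a fork in T.

  module TreeAndAttached {n : ℕ} (T : Graph n) (tree : IsTree T) (v : Fin n) (ℓ : ℕ) where
    open RootedTree T tree v
    open AttachedPath T tree v
    module RT = RootedGraph T depth parent symT edge-depth lower-unique parent-edge
    module RG = RootedGraph (G ℓ) (heightG ℓ) (parG ℓ) (symG ℓ) (edgeG ℓ) (lower-uniqueG ℓ) (parG-edge ℓ)

    high⇒old : ∀ z → ℓ ≤ heightG ℓ z → ∃ λ a → z ≡ a ↑ˡ ℓ
    high⇒old z le with view ℓ z
    ... | old a = a , refl
    ... | new k = ⊥-elim (<-irrefl refl (≤-trans (newHeight<ℓ ℓ k) (subst (ℓ ≤_) (heightG-new ℓ k) le)))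

    old-height≥ℓ : ∀ a → ℓ ≤ heightG ℓ (a ↑ˡ ℓ)
    old-height≥ℓ a = subst (ℓ ≤_) (sym (heightG-old ℓ a)) (m≤m+n ℓ (depth a))

    child-of-old : ∀ {c b} → RG.Parent c (b ↑ˡ ℓ) → ∃ λ c' → c ≡ c' ↑ˡ ℓ × RT.Parent c' b
    child-of-old {c} {b} (e , eq) with view ℓ c
    ... | old c' = c' , refl , cast (old-old ℓ c' b) e ,
           +-cancelˡ-≡ ℓ _ _ (trans (sym (heightG-old ℓ c')) (trans eq (trans (cong suc (heightG-old ℓ b)) (sym (+-suc ℓ (depth b))))))
    ... | new k = ⊥-elim (<-asym (new<old ℓ k b)
                     (subst (ℓ + depth b <_) (trans (sym eq) (heightG-new ℓ k)) (≤-reflexive (cong suc (sym (heightG-old ℓ b))))))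

    parent-old-old : ∀ {a b} → RT.Parent a b → RG.Parent (a ↑ˡ ℓ) (b ↑ˡ ℓ)
    parent-old-old {a} {b} (e , eq) = cast (sym (old-old ℓ a b)) e ,
      trans (heightG-old ℓ a) (trans (cong (ℓ +_) eq) (trans (+-suc ℓ (depth b)) (cong suc (sym (heightG-old ℓ b)))))

    child-of-new : ∀ {c} (k : Fin ℓ) → RG.Parent c (n ↑ʳ k) →
      (c ≡ v ↑ˡ ℓ × toℕ k ≡ 0) ⊎ (Σ (Fin ℓ) λ m → c ≡ n ↑ʳ m × toℕ k ≡ suc (toℕ m))
    child-of-new {c} k (e , eq) with view ℓ c
    ... | old a with cast (old-new ℓ a k) e
    ...   | refl , k0 = inj₁ (refl , k0)
    child-of-new {c} k (e , eq) | new m with cast (new-new ℓ m k) e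
    ...   | inj₁ m<k = inj₂ (m , refl , sym m<k)
    ...   | inj₂ k<m = ⊥-elim (m≢2+m (toℕ k) (trans (newHeight-step ℓ m k
              (trans (sym (heightG-new ℓ m)) (trans eq (cong suc (heightG-new ℓ k))))) (cong suc (sym k<m))))

    new-one-child : ∀ {c1 c2} (k : Fin ℓ) → RG.Parent c1 (n ↑ʳ k) → RG.Parent c2 (n ↑ʳ k) → c1 ≡ c2
    new-one-child k p1 p2 with child-of-new k p1 | child-of-new k p2
    ... | inj₁ (refl , _) | inj₁ (refl , _) = refl
    ... | inj₁ (_ , k0) | inj₂ (_ , _ , ks) = ⊥-elim (0≢1+n (trans (sym k0) ks))
    ... | inj₂ (_ , _ , ks) | inj₁ (_ , k0) = ⊥-elim (0≢1+n (trans (sym k0) ks))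
    ... | inj₂ (m , refl , ks) | inj₂ (m' , refl , ks') = cong (n ↑ʳ_) (toℕ-injective (suc-injective (trans (sym ks) ks')))

    ascent-to-old : ∀ {x b i} → RG.Ascent x (b ↑ˡ ℓ) i → ∃ λ x' → x ≡ x' ↑ˡ ℓ × RT.Ascent x' b i
    ascent-to-old RG.here = _ , refl , RT.here
    ascent-to-old (RG.step p u) with ascent-to-old u
    ... | _ , refl , u' with child-of-old p
    ...   | x' , refl , p' = x' , refl , RT.step p' u'

    valley⇒fork : ∀ {L} (xs : Vec (Fin (n + ℓ)) (suc L)) → RG.Valley xs → RT.Fork L
    valley⇒fork xs (_ , RG.fork a b1 b2 y i j p1 p2 ne u1 u2 eqL) with view ℓ a
    ... | new k = ⊥-elim (ne (new-one-child k p1 p2))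
    ... | old a' with child-of-old p1 | child-of-old p2
    ...   | b1' , refl , p1' | b2' , refl , p2' with ascent-to-old u1 | ascent-to-old u2
    ...     | x' , _ , u1' | y' , _ , u2' =
      x' , RT.fork a' b1' b2' y' i j p1' p2' (λ eq → ne (cong (_↑ˡ ℓ) eq)) u1' u2' eqL

  -- If deg v ≥ 2 the
  -- ends of the fork would be further apart than diam T = t_v.  If v is a leaf,
  -- let u be a branching vertex nearest to v: the vertices up to depth u form a
  -- single stem v … u, the fork lies below u, and its ends would be further apart
  -- than the diameter t_v of the component of u in T − {parent u, u}.

  module LongForks {n : ℕ} (T : Graph n) (tree : IsTree T) (v : Fin n) (ℓ : ℕ)
    (tv<ℓ : ∀ D → IsTV T v (ℤ.+ D) → D < ℓ) where
    open RootedTree T tree v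
    open TreeAndAttached T tree v ℓ using (module RT)
    open Walks T

    squeeze : ∀ {D d L} → D < ℓ → ℓ ≤ L → L ≤ d → d ≤ D → ⊥
    squeeze D<ℓ ℓ≤L L≤d d≤D = <-irrefl refl (<-≤-trans D<ℓ (≤-trans ℓ≤L (≤-trans L≤d d≤D)))

    deg2? : ∀ w → Dec (DegAtLeast2 T w)
    deg2? w = any? λ a → any? λ b → decT w a ×-dec decT w b ×-dec ¬? (a ≟ b)

    deg3? : ∀ w → Dec (DegAtLeast3 T w)
    deg3? w = any? λ a → any? λ b → any? λ c → decT w a ×-dec decT w b ×-dec decT w c ×-dec
              ¬? (a ≟ b) ×-dec ¬? (a ≟ c) ×-dec ¬? (b ≟ c)

    deg3⇒deg2 : ∀ {w} → DegAtLeast3 T w → DegAtLeast2 T w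
    deg3⇒deg2 (a , b , c , ea , eb , ec , a≢b , _ , _) = a , b , ea , eb , a≢b

    two-children-deg2 : ∀ {p c1 c2} → RT.Parent c1 p → RT.Parent c2 p → c1 ≢ c2 → DegAtLeast2 T p
    two-children-deg2 p1 p2 ne = _ , _ , symT (proj₁ p1) , symT (proj₁ p2) , ne

    two-children-deg3 : ∀ {p c1 c2} → RT.Parent c1 p → RT.Parent c2 p → c1 ≢ c2 → depth p ≢ 0 → DegAtLeast3 T p
    two-children-deg3 {p} p1 p2 ne nz =
      _ , _ , parent p , symT (proj₁ p1) , symT (proj₁ p2) , proj₁ pp , ne , child≢parent p1 , child≢parent p2
      where
      pp = RT.par-parent p nz
      child≢parent : ∀ {c} → RT.Parent c p → c ≢ parent p
      child≢parent pc refl = RT.parent-asym pc pp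

    path-from-root : ∀ {m} (zs : Vec (Fin n) m) w → IsPathV T ((v ∷ zs) ++ (w ∷ [])) → depth w ≡ suc m
    path-from-root {m} zs w ((iw , _) , d) = subst (λ z → depth z ≡ suc m) (last-++ v zs w)
      (trans (proj₁ (by-rootPath (fromVec _ iw) (fromVec-path _ iw d))) (+-comm m 1))

    -- Deleting the edge between u and its parent W, the component of u consists
    -- of the descendants of u.
    module Component (u W : Fin n) (u-W : RT.Parent u W) where
      DE : Graph n
      DE = DeleteEdge T W u

      symDE : ∀ {p q} → DE p q → DE q p
      symDE (e , nd) = symT e , λ { (inj₁ (a1 , a2)) → nd (inj₂ (a2 , a1)) ; (inj₂ (a1 , a2)) → nd (inj₁ (a2 , a1)) }

      decDE : ∀ p q → Dec (DE p q)
      decDE p q = decT p q ×-dec ¬? (((p ≟ W) ×-dec (q ≟ u)) ⊎-dec ((p ≟ u) ×-dec (q ≟ W)))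

      module WD = Walks DE
      open WD.Reverse symDE

      InComponent : Fin n → Set
      InComponent z = ∃ λ d → WalkOfLen DE u z d

      ascent-avoids : ∀ {c k} → RT.Ascent c u k → WD.Walk c u k
      ascent-avoids RT.here = WD.nil
      ascent-avoids (RT.step {x = c} {y = c'} p up) = WD.cons (proj₁ p , not-deleted) (ascent-avoids up)
        where
        u<c : depth u < depth c
        u<c = subst (depth u <_) (sym (proj₂ p)) (s≤s (subst (depth u ≤_) (sym (RT.ascent-height up)) (m≤n+m (depth u) _)))
        not-deleted : ¬ ((c ≡ W × c' ≡ u) ⊎ (c ≡ u × c' ≡ W))
        not-deleted (inj₁ (refl , _)) = <-asym (≤-reflexive (sym (proj₂ u-W))) u<c
        not-deleted (inj₂ (refl , _)) = <-irrefl refl u<c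

      stays-below : ∀ {s z d} → RT.Below u s → WD.Walk s z d → RT.Below u z
      stays-below below WD.nil = below
      stays-below below (WD.cons (e , nd) w) = stays-below (step below nd (RT.edge-parent e)) w
        where
        step : ∀ {s c} → RT.Below u s → ¬ ((s ≡ W × c ≡ u) ⊎ (s ≡ u × c ≡ W)) →
               RT.Parent s c ⊎ RT.Parent c s → RT.Below u c
        step (k , up) nd (inj₂ p) = suc k , RT.step p up
        step (zero , RT.here) nd (inj₁ p) = ⊥-elim (nd (inj₂ (refl , RT.parent-unique p u-W)))
        step (suc k , RT.step p' up) nd (inj₁ p) with RT.parent-unique p p'
        ... | refl = k , up

      below⇒in : ∀ {z} → RT.Below u z → InComponent z
      below⇒in (k , up) = k , WD.toWalkOfLen (rev (ascent-avoids up))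

      inComponent? : ∀ z → Dec (InComponent z)
      inComponent? z = map′ below⇒in (λ { (d , wl) → stays-below (0 , RT.here) (WD.fromWalkOfLen wl) }) (RT.below? u z)

      joined : ∀ p q → InComponent p → InComponent q → Σ ℕ (WD.Walk p q)
      joined p q (d1 , w1) (d2 , w2) = _ , (rev (WD.fromWalkOfLen w1) WD.++W WD.fromWalkOfLen w2)

      forget : ∀ {p q d} → WD.Walk p q d → Walk p q d
      forget WD.nil = nil
      forget (WD.cons e w) = cons (proj₁ e) (forget w)

    -- If v is a leaf and no vertex above u branches, the vertices of depth at
    -- most depth u form a stem v = top 0, top 1, …, top (depth u) = u.
    module Stem (v-leaf : ¬ DegAtLeast2 T v) (u : Fin n)
                (narrow : ∀ w → depth w < depth u → ¬ DegAtLeast3 T w) where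
      top : ℕ → Fin n
      top s = RT.ancestor (depth u ∸ s) u

      top-depth : ∀ s → s ≤ depth u → depth (top s) ≡ s
      top-depth s le = trans (RT.ancestor-height _ u (m∸n≤m _ s)) (m∸[m∸n]≡n le)

      top-parent : ∀ s → s < depth u → RT.Parent (top (suc s)) (top s)
      top-parent s lt = subst (RT.Parent (top (suc s))) (cong (λ k → RT.ancestor k u) (sym (∸-suc′ lt)))
        (RT.ancestor-parent (depth u ∸ suc s) u (subst (_≤ depth u) (∸-suc′ lt) (m∸n≤m (depth u) s)))

      top-root : top 0 ≡ v
      top-root = depth0⇒root _ (top-depth 0 z≤n)

      top-u : top (depth u) ≡ u
      top-u = cong (λ k → RT.ancestor k u) (n∸n≡0 (depth u))

      one-child : ∀ s {w} → RT.Parent w (top s) → w ≢ top (suc s) → suc s ≤ depth u → ⊥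
      one-child zero pw ne le = v-leaf (subst (DegAtLeast2 T) top-root (two-children-deg2 pw (top-parent 0 le) ne))
      one-child (suc s) pw ne le = narrow (top (suc s)) (subst (_< depth u) (sym (top-depth (suc s) (<⇒≤ le))) le)
        (two-children-deg3 pw (top-parent (suc s) le) ne (λ z → 0≢1+n (trans (sym z) (top-depth (suc s) (<⇒≤ le)))))

      stem : ∀ s w → depth w ≡ s → s ≤ depth u → w ≡ top s
      stem zero w eq _ = trans (depth0⇒root w eq) (sym top-root)
      stem (suc s) w eq le with w ≟ top (suc s)
      ... | yes w≡ = w≡
      ... | no w≢ = ⊥-elim (one-child s (subst (RT.Parent w) parent-on-stem pw) w≢ le)
        where
        pw = RT.par-parent w (λ z → 0≢1+n (trans (sym z) eq))
        parent-on-stem : parent w ≡ top s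
        parent-on-stem = stem s (parent w) (suc-injective (trans (sym (proj₂ pw)) eq)) (<⇒≤ le)

      -- every vertex at least as deep as u lies below u: its ancestor at the
      -- depth of u is on the stem, hence is u itself
      below-u : ∀ w → depth u ≤ depth w → RT.Below u w
      below-u w le = k , subst (λ c′ → RT.Ascent w c′ k) (trans (stem (depth u) c depth-c ≤-refl) top-u) (RT.ancestor-ascent k w (m∸n≤m (depth w) (depth u)))
        where
        k = depth w ∸ depth u
        c = RT.ancestor k w
        depth-c : depth c ≡ depth u
        depth-c = trans (RT.ancestor-height k w (m∸n≤m (depth w) (depth u))) (m∸[m∸n]≡n le)

    module _ {x L} (F : RT.ForkFrom x L) (ℓ≤L : ℓ ≤ L) where
      open RT.ForkFrom F renaming (apex to a)

      -- if deg v ≥ 2 then t_v = diam T, but dist(x, y) ≥ L ≥ ℓ > t_v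
      branching-root : DegAtLeast2 T v → ⊥
      branching-root dv = squeeze (tv<ℓ D (deg≥2 D dv diam)) ℓ≤L
                                  (RT.fork-distance F (fromWalkOfLen (proj₁ dxy))) (proj₂ diam x y _ tt tt dxy)
        where
        walkT : ∀ p q → Σ ℕ (Walk p q)
        walkT p q = _ , fromWalkOfLen (proj₂ (connected p q))
        open Distances T decT
        open Diameter (λ _ → ⊤) (λ _ → yes tt) (λ p q _ _ → walkT p q) v tt
        dxy = proj₂ (distance x y (proj₂ (walkT x y)))

      module LeafRoot (v-leaf : ¬ DegAtLeast2 T v) where
        a-deg3 : DegAtLeast3 T a
        a-deg3 = two-children-deg3 b1-child b2-child b1≢b2
          (λ z → v-leaf (subst (DegAtLeast2 T) (depth0⇒root a z) (two-children-deg2 b1-child b2-child b1≢b2)))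

        nearest : Σ ℕ λ t → (Σ (Fin n) λ w → depth w ≡ t × DegAtLeast3 T w) ×
                            (∀ t' → (Σ (Fin n) λ w → depth w ≡ t' × DegAtLeast3 T w) → t ≤ t')
        nearest = least _ (λ t → any? λ w → (depth w ℕ.≟ t) ×-dec deg3? w) (depth a) (a , refl , a-deg3)

        u : Fin n
        u = proj₁ (proj₁ (proj₂ nearest))

        u-deg3 : DegAtLeast3 T u
        u-deg3 = proj₂ (proj₂ (proj₁ (proj₂ nearest)))

        nearest-min : ∀ w → DegAtLeast3 T w → depth u ≤ depth w
        nearest-min w d3 = subst (_≤ depth w) (sym (proj₁ (proj₂ (proj₁ (proj₂ nearest))))) (proj₂ (proj₂ nearest) _ (w , refl , d3))

        u-nonroot : depth u ≢ 0
        u-nonroot z = v-leaf (subst (DegAtLeast2 T) (depth0⇒root u z) (deg3⇒deg2 u-deg3))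

        open Stem v-leaf u (λ w lt d3 → <⇒≱ lt (nearest-min w d3))

        -- the path v … u in the form required by the definition of t_v
        module PathToU (k : ℕ) (depth-u : depth u ≡ suc k) where
          ys : Vec (Fin n) k
          ys = RT.strictAncestors u k

          v-to-u : IsPathV T ((v ∷ ys) ++ (u ∷ []))
          v-to-u = subst (λ z → IsPathV T ((z ∷ ys) ++ (u ∷ []))) top-is-v
                       (RT.down-path _ (RT.ancestors-down u k (≤-reflexive (sym depth-u))))
            where
            top-is-v : RT.ancestor (suc k) u ≡ v
            top-is-v = depth0⇒root _ (trans (RT.ancestor-height (suc k) u (≤-reflexive (sym depth-u)))
                                            (trans (cong (_∸ suc k) depth-u) (n∸n≡0 (suc k))))

          last-is-parent : last (v ∷ ys) ≡ parent u
          last-is-parent = last-ancestors k depth-u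
            where
            last-ancestors : ∀ k → depth u ≡ suc k → last (v ∷ RT.strictAncestors u k) ≡ parent u
            last-ancestors zero eq =
              sym (depth0⇒root (parent u) (suc-injective (trans (sym (proj₂ (RT.par-parent u u-nonroot))) eq)))
            last-ancestors (suc k′) _ = RT.last-strictAncestors u v k′

          shortest : ∀ {m} (zs : Vec (Fin n) m) u' → IsPathV T ((v ∷ zs) ++ (u' ∷ [])) → DegAtLeast3 T u' → k ≤ m
          shortest zs u' p d3 = ≤-pred (subst₂ _≤_ depth-u (path-from-root zs u' p) (nearest-min u' d3))

          open Component u (last (v ∷ ys)) (subst (RT.Parent u) (sym last-is-parent) (RT.par-parent u u-nonroot))
          open Distances DE decDE
          open Diameter InComponent inComponent? joined u (0 , WD.toWalkOfLen WD.nil)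

          -- the fork hangs below u, so both its ends lie in the component of u
          a-below-u : RT.Ascent a u (depth a ∸ depth u)
          a-below-u = proj₂ (below-u a (nearest-min a a-deg3))

          x-in : InComponent x
          x-in = below⇒in (_ , RT.ascent-trans x-below (RT.step b1-child a-below-u))

          y-in : InComponent y
          y-in = below⇒in (_ , RT.ascent-trans y-below (RT.step b2-child a-below-u))

          dxy = proj₂ (distance x y (proj₂ (joined x y x-in y-in)))

          absurd : ⊥
          absurd = squeeze (tv<ℓ D (leaf ys u D v-leaf (λ pg → path-graph-degree pg u u-deg3) v-to-u u-deg3 shortest diam))
                           ℓ≤L (RT.fork-distance F (forget (WD.fromWalkOfLen (proj₁ dxy)))) (proj₂ diam x y _ x-in y-in dxy)

        absurd : ⊥
        absurd = PathToU.absurd (pred (depth u)) (sym (suc-pred (depth u) {{≢-nonZero u-nonroot}}))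

    no-long-fork : ∀ {L} → RT.Fork L → ℓ ≤ L → ⊥
    no-long-fork (x , F) ℓ≤L with deg2? v
    ... | yes dv = branching-root F ℓ≤L dv
    ... | no v-leaf = LeafRoot.absurd F ℓ≤L v-leaf

  -- Every ℓ- or (ℓ+1)-link of G = T(v,ℓ) is an
  -- up- or a down-chain (a valley would be a fork of size ≥ ℓ in T), hence a
  -- path.  The ℓ-links are, up to reversal, exactly the up-chains φ x of length
  -- ℓ from old vertices x, and the only (ℓ+1)-link joining φ x and φ y is the
  -- up-chain from whichever of x, y is the child of the other.

  module LinkGraphOfAttached {n : ℕ} (T : Graph n) (tree : IsTree T) (v : Fin n) (ℓ : ℕ)
    (tv<ℓ : ∀ D → IsTV T v (ℤ.+ D) → D < ℓ) where
    open RootedTree T tree v using (symT)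
    open AttachedPath T tree v
    open TreeAndAttached T tree v ℓ
    open LongForks T tree v ℓ tv<ℓ using (no-long-fork)

    monotone : ∀ {L} (xs : Vec (Fin (n + ℓ)) (suc L)) → IsLink (G ℓ) xs → ℓ ≤ L → RG.Up xs ⊎ RG.Down xs
    monotone xs lk le with RG.classify xs lk
    ... | inj₁ u = inj₁ u
    ... | inj₂ (inj₁ d) = inj₂ d
    ... | inj₂ (inj₂ val) = ⊥-elim (no-long-fork (valley⇒fork xs val) le)

    link-path : ∀ {L} (xs : Vec (Fin (n + ℓ)) (suc L)) → IsLink (G ℓ) xs → ℓ ≤ L → IsPathV (G ℓ) xs
    link-path xs lk le = [ RG.up-path xs , RG.down-path xs ]′ (monotone xs lk le)

    φ : Fin n → Vec (Fin (n + ℓ)) (suc ℓ)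
    φ x = RG.chain (x ↑ˡ ℓ) ℓ

    φ-path : ∀ x → IsPathV (G ℓ) (φ x)
    φ-path x = RG.up-path (φ x) (RG.chain-up (x ↑ˡ ℓ) ℓ (old-height≥ℓ x))

    chain-injective : ∀ L z w → L ≤ heightG ℓ z → L ≤ heightG ℓ w → RG.chain z L ≈L RG.chain w L → z ≡ w
    chain-injective L z w _ _ (inj₁ eq) = trans (sym (RG.head-chain z L)) (trans (cong head eq) (RG.head-chain w L))
    chain-injective zero z w _ _ (inj₂ eq) = cong head eq
    chain-injective (suc L) z w lz lw (inj₂ eq) =
      ⊥-elim (RG.up-not-down (RG.chain z (suc L)) (RG.chain-up z (suc L) lz)
                (subst RG.Down (sym eq) (RG.up-reverse (RG.chain w (suc L)) (RG.chain-up w (suc L) lw))))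

    φ-injective : ∀ x y → φ x ≈L φ y → x ≡ y
    φ-injective x y eq = ↑ˡ-injective ℓ x y (chain-injective ℓ _ _ (old-height≥ℓ x) (old-height≥ℓ y) eq)

    φ-onto : ∀ P → IsLink (G ℓ) P → ∃ λ x → φ x ≈L P
    φ-onto P lk with monotone P lk ≤-refl
    ... | inj₁ u = let x , eq = high⇒old (head P) (RG.up-height P u) in
      x , inj₁ (sym (trans (RG.up-chain P u) (cong (λ z → RG.chain z ℓ) eq)))
    ... | inj₂ d = let u = RG.down-reverse P d ; x , eq = high⇒old (head (reverse P)) (RG.up-height (reverse P) u) in
      x , inj₂ (sym (trans (RG.up-chain (reverse P) u) (cong (λ z → RG.chain z ℓ) eq)))

    JoinedBy : Vec (Fin (n + ℓ)) (suc (suc ℓ)) → Fin n → Fin n → Set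
    JoinedBy R x y = (R ≈L RG.chain (x ↑ˡ ℓ) (suc ℓ) × RG.Parent (x ↑ˡ ℓ) (y ↑ˡ ℓ)) ⊎
                     (R ≈L RG.chain (y ↑ˡ ℓ) (suc ℓ) × RG.Parent (y ↑ˡ ℓ) (x ↑ˡ ℓ))

    chain-ends : ∀ r x y → suc ℓ ≤ heightG ℓ r → init (RG.chain r (suc ℓ)) ≈L φ x → tail (RG.chain r (suc ℓ)) ≈L φ y →
                 r ≡ x ↑ˡ ℓ × RG.Parent r (y ↑ˡ ℓ)
    chain-ends r x y lr ix ty =
      chain-injective ℓ r _ (<⇒≤ lr) (old-height≥ℓ x) (subst (_≈L φ x) (RG.init-chain r ℓ) ix) ,
      subst (RG.Parent r) (chain-injective ℓ (parG ℓ r) _ (≤-pred (subst (suc ℓ ≤_) (proj₂ pr) lr)) (old-height≥ℓ y) ty) pr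
      where
      pr : RG.Parent r (parG ℓ r)
      pr = RG.par-parent r (λ z → 0≢1+n (sym (n≤0⇒n≡0 (subst (suc ℓ ≤_) z lr))))

    up-joining : ∀ R x y → RG.Up R → Joins R (φ x) (φ y) → JoinedBy R x y
    up-joining R x y u j with RG.up-chain R u | RG.up-height R u
    ... | R≡ | lr rewrite R≡ with j
    ...   | inj₁ (ix , ty) = let r≡ , p = chain-ends (head R) x y lr ix ty in
                             inj₁ (subst (λ z → _ ≈L RG.chain z (suc ℓ)) r≡ (inj₁ refl) , subst (λ z → RG.Parent z _) r≡ p)
    ...   | inj₂ (iy , tx) = let r≡ , p = chain-ends (head R) y x lr iy tx in
                             inj₂ (subst (λ z → _ ≈L RG.chain z (suc ℓ)) r≡ (inj₁ refl) , subst (λ z → RG.Parent z _) r≡ p)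

    joining-link : ∀ R x y → IsLink (G ℓ) R → Joins R (φ x) (φ y) → JoinedBy R x y
    joining-link R x y lk j with monotone R lk (n≤1+n ℓ)
    ... | inj₁ u = up-joining R x y u j
    ... | inj₂ d with up-joining (reverse R) x y (RG.down-reverse R d) (joins-reverse {R = R} j)
    ...   | inj₁ (e , p) = inj₁ (≈revl⁻ e , p)
    ...   | inj₂ (e , p) = inj₂ (≈revl⁻ e , p)

    joined-unique : ∀ {R R' x y} → JoinedBy R x y → JoinedBy R' x y → R ≈L R'
    joined-unique (inj₁ (e , _)) (inj₁ (e' , _)) = ≈trans e (≈sym e')
    joined-unique (inj₂ (e , _)) (inj₂ (e' , _)) = ≈trans e (≈sym e')
    joined-unique (inj₁ (_ , p)) (inj₂ (_ , p')) = ⊥-elim (RG.parent-asym p p')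
    joined-unique (inj₂ (_ , p)) (inj₁ (_ , p')) = ⊥-elim (RG.parent-asym p p')

    adjacent-link : ∀ {P Q} → PAdj (G ℓ) ℓ P Q → Σ (Vec (Fin (n + ℓ)) (suc (suc ℓ))) λ R → IsLink (G ℓ) R × Joins R P Q
    adjacent-link (R , inj₁ pth , j) = R , proj₁ pth , j
    adjacent-link (R , inj₂ cyc , j) = R , Walks.cycle-link (G ℓ) R cyc , j

    linkGraph≡pathGraph : LinkGraph≡PathGraph (G ℓ) ℓ
    linkGraph≡pathGraph =
      (λ P lk → link-path P lk ≤-refl) ,
      λ P Q pP pQ → (λ R lk j → R , inj₁ (link-path R lk (n≤1+n ℓ)) , j) ,
        λ pa → adjacent-link pa , λ R R' lk lk' j j' →
          let x , φx≈P = φ-onto P (proj₁ pP)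
              y , φy≈Q = φ-onto Q (proj₁ pQ)
              joins : ∀ R → Joins R P Q → Joins R (φ x) (φ y)
              joins R j = joins-resp {R = R} j (≈sym φx≈P) (≈sym φy≈Q)
          in joined-unique (joining-link R x y lk (joins R j)) (joining-link R' x y lk' (joins R' j'))

    parent-link : ∀ {x y} → RT.Parent x y →
                  Σ (Vec (Fin (n + ℓ)) (suc (suc ℓ))) λ R → IsPathV (G ℓ) R × init R ≡ φ x × tail R ≡ φ y
    parent-link {x} {y} p = RG.chain (x ↑ˡ ℓ) (suc ℓ) , RG.up-path _ (RG.chain-up _ (suc ℓ) high) ,
                            RG.init-chain (x ↑ˡ ℓ) ℓ , cong (λ z → RG.chain z ℓ) (sym (RG.parent≡par pg))
      where
      pg = parent-old-old p
      high : suc ℓ ≤ heightG ℓ (x ↑ˡ ℓ)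
      high = subst (suc ℓ ≤_) (sym (proj₂ pg)) (s≤s (old-height≥ℓ y))

    edge⇒adjacent : ∀ x y → T x y → PAdj (G ℓ) ℓ (φ x) (φ y)
    edge⇒adjacent x y e with RT.edge-parent e
    ... | inj₁ p = let R , pth , ei , et = parent-link p in R , inj₁ pth , inj₁ (inj₁ ei , inj₁ et)
    ... | inj₂ p = let R , pth , ei , et = parent-link p in R , inj₁ pth , inj₂ (inj₁ ei , inj₁ et)

    parent-old⇒edge : ∀ {x y} → RG.Parent (x ↑ˡ ℓ) (y ↑ˡ ℓ) → T x y
    parent-old⇒edge {x} {y} p with child-of-old p
    ... | x' , eq , p' = subst (λ z → T z y) (sym (↑ˡ-injective ℓ x x' eq)) (proj₁ p')

    adjacent⇒edge : ∀ x y → PAdj (G ℓ) ℓ (φ x) (φ y) → T x y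
    adjacent⇒edge x y pa with adjacent-link pa
    ... | R , lk , j with joining-link R x y lk j
    ...   | inj₁ (_ , p) = parent-old⇒edge p
    ...   | inj₂ (_ , p) = symT (parent-old⇒edge p)

    tree≅pathGraph : Iso-PathGraph T (G ℓ) ℓ
    tree≅pathGraph = φ , φ-path , φ-injective , (λ P pth → φ-onto P (proj₁ pth)) ,
                     λ x y → mk⇔ (edge⇒adjacent x y) (adjacent⇒edge x y)

open import Data.Nat using (ℕ)
open import Data.Fin using (Fin)
open import Data.Integer using (ℤ; +_; _+_; _≤_)
open import Data.Integer.Properties using (drop‿+≤+)
open import Data.Nat.Properties using (+-comm; ≤-trans; ≤-reflexive)
open import Data.Product using (_×_; _,_)

lemma3p3 : ∀ {n} (T : Graph n) → IsTree T → (v : Fin n) → (ℓ : ℕ) →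
    (∀ (t : ℤ) → IsTV T v t → t + + 1 ≤ + ℓ) →
    LinkGraph≡PathGraph (Attach T v ℓ) ℓ × Iso-PathGraph T (Attach T v ℓ) ℓ
lemma3p3 T tree v ℓ tv+1≤ℓ = linkGraph≡pathGraph , tree≅pathGraph
  where
  -- only t_v ≥ 0 matters: then t_v + 1 ≤ ℓ says t_v < ℓ in ℕ
  open Development.LinkGraphOfAttached T tree v ℓ (λ D tv → ≤-trans (≤-reflexive (+-comm 1 D)) (drop‿+≤+ (tv+1≤ℓ (+ D) tv)))
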